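{- Let $C_n=\frac{1}{n+1}\binom{2n}{n}$ and $C(x)=\sum_{n\ge0}C_nx^n=\frac{1-\sqrt{1-4x}}{2x}$, with $C'(x)$ its derivative. For $n\ge1$ let $H_n=\sum_{\pi\in\mathrm{Av}_n(213)}\sum_{t=1}^{n-1}\min\{\pi_t,\pi_{t+1}\}$, where $\mathrm{Av}_n(213)$ is the set of $213$-avoiding permutations of $[n]$, and let $H(x)=\sum_{n\ge1}H_nx^n$. Then, as formal power series, \[ (1-2xC(x))\,H(x)=x\bigl(xC'(x)-C(x)+1\bigr)\bigl(xC'(x)+2C(x)\bigr)+2\bigl(C(x)-1-xC(x)\bigr). \]
   Context: A permutation $\pi$ of $[n]$ avoids $213$ if there are no indices $p<q<r$ with $\pi_q<\pi_p<\pi_r$. -}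

module Defs where

open import Data.Nat as ℕ using (ℕ; zero; suc; _⊓_)
open import Data.Nat.Combinatorics using (_C_)
open import Data.Nat.DivMod using (_/_)
open import Data.Integer as ℤ using (ℤ; +_; _+_; _-_; _*_)
open import Data.Fin as Fin using (Fin; toℕ)
open import Data.Fin.Properties using (all?)
open import Data.Vec using (Vec; []; _∷_; lookup; toList)
open import Data.Nat.ListAction using (sum)
open import Data.List as List using (List; [_]; concatMap; map; allFin; filter)
open import Data.Product using (_×_; _,_)
open import Relation.Binary.PropositionalEquality using (_≡_)
open import Relation.Nullary using (¬_; Dec)
open import Relation.Nullary.Decidable using (_×-dec_; ¬?; _→-dec_)
open import Data.Fin.Properties using (_≟_)

catalan : ℕ → ℕ
catalan n = ((2 ℕ.* n) C n) / suc n

-- Permutations of [n] avoiding 213.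
-- A word of length n over Fin n (value i : Fin n stands for i+1 ∈ [n]),
-- i.e. π_t = toℕ (lookup π (t-1)) + 1.

Word : ℕ → Set
Word n = Vec (Fin n) n

allVecs : (k n : ℕ) → List (Vec (Fin n) k)
allVecs zero    n = [ [] ]
allVecs (suc k) n = concatMap (λ i → map (i ∷_) (allVecs k n)) (allFin n)

IsPerm : ∀ {n} → Word n → Set
IsPerm {n} π = ∀ (i j : Fin n) → lookup π i ≡ lookup π j → i ≡ j

Avoids213 : ∀ {n} → Word n → Set
Avoids213 {n} π = ∀ (p q r : Fin n) → p Fin.< q → q Fin.< r →
  ¬ (lookup π q Fin.< lookup π p × lookup π p Fin.< lookup π r)

isPerm? : ∀ {n} (π : Word n) → Dec (IsPerm π)
isPerm? π = all? λ i → all? λ j → (lookup π i ≟ lookup π j) →-dec (i ≟ j)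

avoids213? : ∀ {n} (π : Word n) → Dec (Avoids213 π)
avoids213? π = all? λ p → all? λ q → all? λ r →
  (p Fin.<? q) →-dec ((q Fin.<? r) →-dec
    ¬? ((lookup π q Fin.<? lookup π p) ×-dec (lookup π p Fin.<? lookup π r)))

Av213 : (n : ℕ) → List (Word n)
Av213 n = filter (λ π → avoids213? π) (filter (λ π → isPerm? π) (allVecs n n))

adjMinSum : List ℕ → ℕ
adjMinSum (a List.∷ b List.∷ rest) = (a ⊓ b) ℕ.+ adjMinSum (b List.∷ rest)
adjMinSum _ = 0

values : ∀ {n} → Word n → List ℕ
values π = map (λ v → suc (toℕ v)) (toList π)

Hnum : ℕ → ℕ
Hnum n = sum (map (λ π → adjMinSum (values π)) (Av213 n))

FPS : Set
FPS = ℕ → ℤ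

sumTo : ℕ → (ℕ → ℤ) → ℤ
sumTo zero    f = f 0
sumTo (suc n) f = sumTo n f + f (suc n)

_⊕_ : FPS → FPS → FPS
(f ⊕ g) n = f n + g n

_⊖_ : FPS → FPS → FPS
(f ⊖ g) n = f n - g n

_⊛_ : FPS → FPS → FPS
(f ⊛ g) n = sumTo n (λ k → f k * g (n ℕ.∸ k))

infixl 6 _⊕_ _⊖_
infixl 7 _⊛_

scale : ℤ → FPS → FPS
scale c f n = c * f n

one : FPS
one zero    = + 1
one (suc n) = + 0

X : FPS
X 1 = + 1
X _ = + 0

deriv : FPS → FPS
deriv f n = + (suc n) * f (suc n)

_≋_ : FPS → FPS → Set
f ≋ g = ∀ n → f n ≡ g n

infix 4 _≋_

Cser : FPS
Cser n = + catalan n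

Hser : FPS
Hser zero    = + 0
Hser (suc n) = + Hnum (suc n)

{-# OPTIONS --safe #-}
-- A 213-avoiding permutation of [m+1] splits at its entry 1 as π = α′ 1 β′, where every entry
-- of α′ exceeds every entry of β′ (otherwise those two entries and the 1 form a 213); so α′ and
-- β′ are shifted copies of arbitrary 213-avoiders, and conversely every such gluing avoids 213.
-- Counting gluings gives A = 1 + xA² for A(x) = Σ |Av_n(213)| xⁿ; differentiating yields
-- (n+2)a_{n+1} = (4n+2)a_n, which the closed form of C_n also satisfies, so A = C. Summing the
-- adjacent minima over gluings (those of α′ are raised by |β′| + 1, those of β′ by 1, and the
-- two junctions with the 1 contribute 1 each) gives H = x(2CH + (C + xC′)xC′ + xC′).
module Submission where

open import Defs

module PowerSeries where

  open import Data.Nat as ℕ using (ℕ; zero; suc; z≤n; s≤s; _∸_)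
  import Data.Nat.Properties as ℕP
  open import Data.Integer as ℤ using (ℤ; +_; -_; _+_; _*_)
  import Data.Integer.Properties as ℤP
  open import Data.Integer.Solver using (module +-*-Solver)
  open import Data.Maybe using (Maybe; just; nothing)
  open import Data.Product using (_,_)
  open import Relation.Nullary using (yes; no)
  open import Relation.Binary.PropositionalEquality
  open import Algebra.Bundles using (CommutativeRing)
  open import Algebra.Properties.CommutativeSemigroup ℤP.+-commutativeSemigroup using (interchange)
  open import Algebra.Solver.Ring.AlmostCommutativeRing
    using (_-Raw-AlmostCommutative⟶_; fromCommutativeRing)
  import Algebra.Solver.Ring

  sumTo-cong : ∀ n {f g : ℕ → ℤ} → (∀ k → k ℕ.≤ n → f k ≡ g k) → sumTo n f ≡ sumTo n g
  sumTo-cong zero    f≗g = f≗g 0 z≤n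
  sumTo-cong (suc n) f≗g =
    cong₂ _+_ (sumTo-cong n (λ k k≤n → f≗g k (ℕP.m≤n⇒m≤1+n k≤n))) (f≗g (suc n) ℕP.≤-refl)

  sumTo-+ : ∀ n (f g : ℕ → ℤ) → sumTo n (λ k → f k + g k) ≡ sumTo n f + sumTo n g
  sumTo-+ zero    f g = refl
  sumTo-+ (suc n) f g = trans (cong (_+ (f (suc n) + g (suc n))) (sumTo-+ n f g))
                              (interchange (sumTo n f) (sumTo n g) (f (suc n)) (g (suc n)))

  sumTo-*ˡ : ∀ n c (f : ℕ → ℤ) → sumTo n (λ k → c * f k) ≡ c * sumTo n f
  sumTo-*ˡ zero    c f = refl
  sumTo-*ˡ (suc n) c f = trans (cong (_+ c * f (suc n)) (sumTo-*ˡ n c f))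
                               (sym (ℤP.*-distribˡ-+ c (sumTo n f) (f (suc n))))

  sumTo-*ʳ : ∀ n c (f : ℕ → ℤ) → sumTo n (λ k → f k * c) ≡ sumTo n f * c
  sumTo-*ʳ zero    c f = refl
  sumTo-*ʳ (suc n) c f = trans (cong (_+ f (suc n) * c) (sumTo-*ʳ n c f))
                               (sym (ℤP.*-distribʳ-+ c (sumTo n f) (f (suc n))))

  sumTo-suc : ∀ n (f : ℕ → ℤ) → sumTo (suc n) f ≡ f 0 + sumTo n (λ k → f (suc k))
  sumTo-suc zero    f = refl
  sumTo-suc (suc n) f = trans (cong (_+ f (suc (suc n))) (sumTo-suc n f)) (ℤP.+-assoc (f 0) _ _)

  sumTo-zeros : ∀ n (f : ℕ → ℤ) → (∀ k → k ℕ.≤ n → f k ≡ + 0) → sumTo n f ≡ + 0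
  sumTo-zeros n f f≗0 = trans (sumTo-cong n f≗0) (zeros n)
    where
    zeros : ∀ n → sumTo n (λ _ → + 0) ≡ + 0
    zeros zero    = refl
    zeros (suc n) = cong (_+ + 0) (zeros n)

  sumTo-last : ∀ n (f : ℕ → ℤ) → (∀ k → k ℕ.< n → f k ≡ + 0) → sumTo n f ≡ f n
  sumTo-last zero    f _   = refl
  sumTo-last (suc n) f f≗0 = trans (cong (_+ f (suc n)) (sumTo-zeros n f (λ k k≤n → f≗0 k (s≤s k≤n))))
                                   (ℤP.+-identityˡ (f (suc n)))

  sumTo-reverse : ∀ n (f : ℕ → ℤ) → sumTo n f ≡ sumTo n (λ k → f (n ∸ k))
  sumTo-reverse zero    f = refl
  sumTo-reverse (suc n) f = begin
    sumTo n f + f (suc n)                     ≡⟨ cong (_+ f (suc n)) (sumTo-reverse n f) ⟩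
    sumTo n (λ k → f (n ∸ k)) + f (suc n)     ≡⟨ ℤP.+-comm _ (f (suc n)) ⟩
    f (suc n) + sumTo n (λ k → f (n ∸ k))     ≡⟨ sumTo-suc n (λ k → f (suc n ∸ k)) ⟨
    sumTo (suc n) (λ k → f (suc n ∸ k))       ∎
    where open ≡-Reasoning

  sumTo-triangle : ∀ n (Φ : ℕ → ℕ → ℤ) →
    sumTo n (λ k → sumTo k (λ l → Φ l (k ∸ l))) ≡ sumTo n (λ l → sumTo (n ∸ l) (Φ l))
  sumTo-triangle zero    Φ = refl
  sumTo-triangle (suc n) Φ = begin
    sumTo n (λ k → sumTo k (λ l → Φ l (k ∸ l))) + (sumTo n (λ l → Φ l (suc n ∸ l)) + Φ (suc n) (n ∸ n))
      ≡⟨ cong₂ (λ s z → s + (sumTo n (λ l → Φ l (suc n ∸ l)) + Φ (suc n) z)) (sumTo-triangle n Φ) (ℕP.n∸n≡0 n) ⟩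
    sumTo n (λ l → sumTo (n ∸ l) (Φ l)) + (sumTo n (λ l → Φ l (suc n ∸ l)) + Φ (suc n) 0)
      ≡⟨ ℤP.+-assoc (sumTo n (λ l → sumTo (n ∸ l) (Φ l))) (sumTo n (λ l → Φ l (suc n ∸ l))) (Φ (suc n) 0) ⟨
    sumTo n (λ l → sumTo (n ∸ l) (Φ l)) + sumTo n (λ l → Φ l (suc n ∸ l)) + Φ (suc n) 0
      ≡⟨ cong (_+ Φ (suc n) 0) (sumTo-+ n _ _) ⟨
    sumTo n (λ l → sumTo (n ∸ l) (Φ l) + Φ l (suc n ∸ l)) + Φ (suc n) 0
      ≡⟨ cong₂ _+_ (sumTo-cong n extend) (cong (λ z → sumTo z (Φ (suc n))) (ℕP.n∸n≡0 n)) ⟨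
    sumTo n (λ l → sumTo (suc n ∸ l) (Φ l)) + sumTo (n ∸ n) (Φ (suc n))
      ∎
    where
    open ≡-Reasoning
    extend : ∀ l → l ℕ.≤ n → sumTo (suc n ∸ l) (Φ l) ≡ sumTo (n ∸ l) (Φ l) + Φ l (suc n ∸ l)
    extend l l≤n rewrite ℕP.+-∸-assoc 1 l≤n = refl

  0ₛ : FPS
  0ₛ _ = + 0

  neg : FPS → FPS
  neg f n = - f n

  ofℕ : (ℕ → ℕ) → FPS
  ofℕ a n = + a n

  cst : ℤ → FPS
  cst c zero    = c
  cst c (suc _) = + 0

  θ : FPS → FPS
  θ f n = + n * f n

  ⊛-cong : ∀ {f g h k} → f ≋ g → h ≋ k → f ⊛ h ≋ g ⊛ k
  ⊛-cong f≋g h≋k n = sumTo-cong n (λ k _ → cong₂ _*_ (f≋g k) (h≋k (n ∸ k)))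

  ⊛-comm : ∀ f g → f ⊛ g ≋ g ⊛ f
  ⊛-comm f g n = begin
    sumTo n (λ k → f k * g (n ∸ k))               ≡⟨ sumTo-reverse n _ ⟩
    sumTo n (λ k → f (n ∸ k) * g (n ∸ (n ∸ k)))   ≡⟨ sumTo-cong n swap ⟩
    sumTo n (λ k → g k * f (n ∸ k))               ∎
    where
    open ≡-Reasoning
    swap : ∀ k → k ℕ.≤ n → f (n ∸ k) * g (n ∸ (n ∸ k)) ≡ g k * f (n ∸ k)
    swap k k≤n rewrite ℕP.m∸[m∸n]≡n k≤n = ℤP.*-comm (f (n ∸ k)) (g k)

  ⊛-assoc : ∀ f g h → (f ⊛ g) ⊛ h ≋ f ⊛ (g ⊛ h)
  ⊛-assoc f g h n = begin
    sumTo n (λ k → sumTo k (λ l → f l * g (k ∸ l)) * h (n ∸ k))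
      ≡⟨ sumTo-cong n (λ k _ → sym (sumTo-*ʳ k (h (n ∸ k)) _)) ⟩
    sumTo n (λ k → sumTo k (λ l → f l * g (k ∸ l) * h (n ∸ k)))
      ≡⟨ sumTo-cong n (λ k _ → sumTo-cong k (λ l l≤k → cong (λ z → f l * g (k ∸ l) * h z) (reindex k l l≤k))) ⟩
    sumTo n (λ k → sumTo k (λ l → Φ l (k ∸ l)))
      ≡⟨ sumTo-triangle n Φ ⟩
    sumTo n (λ l → sumTo (n ∸ l) (Φ l))
      ≡⟨ sumTo-cong n (λ l _ → trans (sumTo-cong (n ∸ l) (λ t _ → ℤP.*-assoc (f l) (g t) _)) (sumTo-*ˡ (n ∸ l) (f l) _)) ⟩
    sumTo n (λ l → f l * sumTo (n ∸ l) (λ t → g t * h (n ∸ l ∸ t)))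
      ∎
    where
    open ≡-Reasoning
    Φ : ℕ → ℕ → ℤ
    Φ l t = f l * g t * h (n ∸ l ∸ t)
    reindex : ∀ k l → l ℕ.≤ k → n ∸ k ≡ n ∸ l ∸ (k ∸ l)
    reindex k l l≤k = trans (cong (n ∸_) (sym (ℕP.m+[n∸m]≡n l≤k))) (sym (ℕP.∸-+-assoc n l (k ∸ l)))

  ⊛-distribˡ : ∀ f g h → f ⊛ (g ⊕ h) ≋ f ⊛ g ⊕ f ⊛ h
  ⊛-distribˡ f g h n =
    trans (sumTo-cong n (λ k _ → ℤP.*-distribˡ-+ (f k) (g (n ∸ k)) (h (n ∸ k)))) (sumTo-+ n _ _)

  ⊛-distribʳ : ∀ f g h → (g ⊕ h) ⊛ f ≋ g ⊛ f ⊕ h ⊛ f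
  ⊛-distribʳ f g h n =
    trans (sumTo-cong n (λ k _ → ℤP.*-distribʳ-+ (f (n ∸ k)) (g k) (h k))) (sumTo-+ n _ _)

  cst-⊛ : ∀ c f → cst c ⊛ f ≋ scale c f
  cst-⊛ c f zero    = refl
  cst-⊛ c f (suc n) = begin
    sumTo (suc n) (λ k → cst c k * f (suc n ∸ k))             ≡⟨ sumTo-suc n _ ⟩
    c * f (suc n) + sumTo n (λ k → + 0 * f (n ∸ k))           ≡⟨ cong (λ z → c * f (suc n) + z) (sumTo-zeros n _ (λ _ _ → refl)) ⟩
    c * f (suc n) + + 0                                       ≡⟨ ℤP.+-identityʳ _ ⟩
    c * f (suc n)                                             ∎
    where open ≡-Reasoning

  cst-1 : cst (+ 1) ≋ one
  cst-1 zero    = refl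
  cst-1 (suc n) = refl

  one-⊛ : ∀ f → one ⊛ f ≋ f
  one-⊛ f n = trans (sumTo-cong n (λ k _ → cong (_* f (n ∸ k)) (sym (cst-1 k))))
                    (trans (cst-⊛ (+ 1) f n) (ℤP.*-identityˡ (f n)))

  X⊛-suc : ∀ f n → (X ⊛ f) (suc n) ≡ f n
  X⊛-suc f n = begin
    sumTo (suc n) (λ k → X k * f (suc n ∸ k))       ≡⟨ sumTo-suc n _ ⟩
    + 0 + sumTo n (λ k → X (suc k) * f (n ∸ k))     ≡⟨ ℤP.+-identityˡ _ ⟩
    sumTo n (λ k → X (suc k) * f (n ∸ k))           ≡⟨ sumTo-cong n (λ k _ → cong (_* f (n ∸ k)) (X-suc k)) ⟩
    (one ⊛ f) n                                     ≡⟨ one-⊛ f n ⟩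
    f n                                             ∎
    where
    open ≡-Reasoning
    X-suc : ∀ k → X (suc k) ≡ one k
    X-suc zero    = refl
    X-suc (suc k) = refl

  -- Wrapping _≋_ in a record makes both series inferable from the type,
  -- which the algebraic bundles and the ring solver rely on.
  infix 4 _≈_
  record _≈_ (f g : FPS) : Set where
    constructor mk≈
    field coeff : f ≋ g
  open _≈_ public

  fps-commutativeRing : CommutativeRing _ _
  fps-commutativeRing = record
    { Carrier = FPS ; _≈_ = _≈_ ; _+_ = _⊕_ ; _*_ = _⊛_ ; -_ = neg ; 0# = 0ₛ ; 1# = one
    ; isCommutativeRing = record
      { isRing = record
        { +-isAbelianGroup = record
          { isGroup = record
            { isMonoid = record
              { isSemigroup = record
                { isMagma = record
                  { isEquivalence = record
                    { refl  = mk≈ (λ _ → refl)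
                    ; sym   = λ p → mk≈ (λ n → sym (coeff p n))
                    ; trans = λ p q → mk≈ (λ n → trans (coeff p n) (coeff q n)) }
                  ; ∙-cong = λ p q → mk≈ (λ n → cong₂ _+_ (coeff p n) (coeff q n)) }
                ; assoc = λ f g h → mk≈ (λ n → ℤP.+-assoc (f n) (g n) (h n)) }
              ; identity = (λ f → mk≈ (λ n → ℤP.+-identityˡ (f n))) , (λ f → mk≈ (λ n → ℤP.+-identityʳ (f n))) }
            ; inverse = (λ f → mk≈ (λ n → ℤP.+-inverseˡ (f n))) , (λ f → mk≈ (λ n → ℤP.+-inverseʳ (f n)))
            ; ⁻¹-cong = λ p → mk≈ (λ n → cong -_ (coeff p n)) }
          ; comm = λ f g → mk≈ (λ n → ℤP.+-comm (f n) (g n)) }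
        ; *-cong = λ p q → mk≈ (⊛-cong (coeff p) (coeff q))
        ; *-assoc = λ f g h → mk≈ (⊛-assoc f g h)
        ; *-identity = (λ f → mk≈ (one-⊛ f)) , (λ f → mk≈ (λ n → trans (⊛-comm f one n) (one-⊛ f n)))
        ; distrib = (λ f g h → mk≈ (⊛-distribˡ f g h)) , (λ f g h → mk≈ (⊛-distribʳ f g h)) }
      ; *-comm = λ f g → mk≈ (⊛-comm f g) } }

  open CommutativeRing fps-commutativeRing public
    using () renaming (setoid to fps-setoid; refl to ≈-refl; sym to ≈-sym; trans to ≈-trans; +-cong to ⊕-cong; *-cong to ⊛-cong≈; -‿cong to neg-cong; +-identityˡ to ⊕-identityˡ)

  cst-homomorphism : ℤ.+-*-rawRing -Raw-AlmostCommutative⟶ fromCommutativeRing fps-commutativeRing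
  cst-homomorphism = record
    { ⟦_⟧    = cst
    ; +-homo = λ a b → mk≈ (λ { zero → refl ; (suc _) → refl })
    ; *-homo = λ a b → mk≈ (λ n → sym (trans (cst-⊛ a (cst b) n) (*-cst a b n)))
    ; -‿homo = λ a → mk≈ (λ { zero → refl ; (suc _) → refl })
    ; 0-homo = mk≈ (λ { zero → refl ; (suc _) → refl })
    ; 1-homo = mk≈ cst-1 }
    where
    *-cst : ∀ a b → scale a (cst b) ≋ cst (a * b)
    *-cst a b zero    = refl
    *-cst a b (suc n) = ℤP.*-zeroʳ a

  cst≟ : (a b : ℤ) → Maybe (cst a ≈ cst b)
  cst≟ a b with a ℤ.≟ b
  ... | yes refl = just ≈-refl
  ... | no _     = nothing

  module FPS-Solver = Algebra.Solver.Ring ℤ.+-*-rawRing (fromCommutativeRing fps-commutativeRing) cst-homomorphism cst≟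

  X⊛deriv : ∀ f → X ⊛ deriv f ≈ θ f
  X⊛deriv f = mk≈ λ { zero → refl ; (suc n) → X⊛-suc (deriv f) n }

  θ-cong : ∀ {f g} → f ≈ g → θ f ≈ θ g
  θ-cong f≈g = mk≈ λ n → cong (+ n *_) (coeff f≈g n)

  θ-⊕ : ∀ f g → θ (f ⊕ g) ≈ θ f ⊕ θ g
  θ-⊕ f g = mk≈ λ n → ℤP.*-distribˡ-+ (+ n) (f n) (g n)

  θ-one : θ one ≈ 0ₛ
  θ-one = mk≈ λ { zero → refl ; (suc n) → ℤP.*-zeroʳ (+ suc n) }

  θ-X : θ X ≈ X
  θ-X = mk≈ λ { zero → refl ; (suc zero) → refl ; (suc (suc n)) → ℤP.*-zeroʳ (+ suc (suc n)) }

  θ-⊛ : ∀ f g → θ (f ⊛ g) ≈ θ f ⊛ g ⊕ f ⊛ θ g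
  θ-⊛ f g = mk≈ λ n → begin
    + n * sumTo n (λ k → f k * g (n ∸ k))
      ≡⟨ sumTo-*ˡ n (+ n) _ ⟨
    sumTo n (λ k → + n * (f k * g (n ∸ k)))
      ≡⟨ sumTo-cong n (leibniz {n}) ⟩
    sumTo n (λ k → + k * f k * g (n ∸ k) + f k * (+ (n ∸ k) * g (n ∸ k)))
      ≡⟨ sumTo-+ n _ _ ⟩
    (θ f ⊛ g ⊕ f ⊛ θ g) n
      ∎
    where
    open ≡-Reasoning
    open +-*-Solver
    split : ∀ a b x y → (a + b) * (x * y) ≡ a * x * y + x * (b * y)
    split = solve 4 (λ a b x y → (a :+ b) :* (x :* y) := a :* x :* y :+ x :* (b :* y)) refl
    leibniz : ∀ {n} k → k ℕ.≤ n → + n * (f k * g (n ∸ k)) ≡ + k * f k * g (n ∸ k) + f k * (+ (n ∸ k) * g (n ∸ k))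
    leibniz {n} k k≤n = begin
      + n * (f k * g (n ∸ k))                 ≡⟨ cong (λ m → + m * (f k * g (n ∸ k))) (ℕP.m+[n∸m]≡n k≤n) ⟨
      + (k ℕ.+ (n ∸ k)) * (f k * g (n ∸ k))   ≡⟨ split (+ k) (+ (n ∸ k)) (f k) (g (n ∸ k)) ⟩
      + k * f k * g (n ∸ k) + f k * (+ (n ∸ k) * g (n ∸ k)) ∎

  linear-combination : ∀ {L R P₁ Q₁ P₂ Q₂} c₁ c₂ →
    L ≈ R ⊕ c₁ ⊛ (P₁ ⊕ neg Q₁) ⊕ c₂ ⊛ (P₂ ⊕ neg Q₂) → P₁ ≈ Q₁ → P₂ ≈ Q₂ → L ≈ R
  linear-combination {R = R} c₁ c₂ L≈ P₁≈Q₁ P₂≈Q₂ = mk≈ λ n → begin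
    _                      ≡⟨ coeff L≈ n ⟩
    R n + _ + _            ≡⟨ cong₂ (λ u v → R n + u + v) (vanishes c₁ P₁≈Q₁ n) (vanishes c₂ P₂≈Q₂ n) ⟩
    R n + + 0 + + 0        ≡⟨ trans (ℤP.+-identityʳ _) (ℤP.+-identityʳ _) ⟩
    R n                    ∎
    where
    open ≡-Reasoning
    vanishes : ∀ c {P Q} → P ≈ Q → c ⊛ (P ⊕ neg Q) ≋ 0ₛ
    vanishes c {P} {Q} P≈Q n = sumTo-zeros n _ λ k _ → begin
      c k * (P (n ∸ k) + - Q (n ∸ k))   ≡⟨ cong (λ z → c k * (z + - Q (n ∸ k))) (coeff P≈Q (n ∸ k)) ⟩
      c k * (Q (n ∸ k) + - Q (n ∸ k))   ≡⟨ cong (c k *_) (ℤP.+-inverseʳ (Q (n ∸ k))) ⟩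
      c k * + 0                         ≡⟨ ℤP.*-zeroʳ (c k) ⟩
      + 0                               ∎

module CatalanNumbers where

  open import Data.Nat
  open import Data.Nat.Properties
  open import Data.Nat.Combinatorics
  open import Data.Nat.DivMod using (_/_; m*n/n≡m)
  open import Data.Nat.Solver using (module +-*-Solver)
  open import Relation.Binary.PropositionalEquality
  open +-*-Solver

  [k+1]*[m+1]C[k+1]≡[m+1]*mCk : ∀ m k → suc k * (suc m C suc k) ≡ suc m * (m C k)
  [k+1]*[m+1]C[k+1]≡[m+1]*mCk zero    zero    = refl
  [k+1]*[m+1]C[k+1]≡[m+1]*mCk zero    (suc k) rewrite k>n⇒nCk≡0 {1} {2 + k} (s≤s (s≤s z≤n)) | *-zeroʳ k = refl
  [k+1]*[m+1]C[k+1]≡[m+1]*mCk (suc m) zero    = trans (+-identityʳ _) (trans (nC1≡n (2 + m)) (sym (*-identityʳ (2 + m))))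
  [k+1]*[m+1]C[k+1]≡[m+1]*mCk (suc m) (suc k) = begin
    suc (suc k) * (suc (suc m) C suc (suc k))   ≡⟨ cong (suc (suc k) *_) (nCk+nC[k+1]≡[n+1]C[k+1] (suc m) (suc k)) ⟨
    suc (suc k) * (c + d)                       ≡⟨ solve 3 (λ k c d → (con 1 :+ k) :* (c :+ d) := k :* c :+ c :+ (con 1 :+ k) :* d) refl (suc k) c d ⟩
    suc k * c + c + suc (suc k) * d             ≡⟨ cong₂ (λ u v → u + c + v) ([k+1]*[m+1]C[k+1]≡[m+1]*mCk m k) ([k+1]*[m+1]C[k+1]≡[m+1]*mCk m (suc k)) ⟩
    suc m * a + c + suc m * b                   ≡⟨ solve 4 (λ m a b c → m :* a :+ c :+ m :* b := m :* (a :+ b) :+ c) refl (suc m) a b c ⟩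
    suc m * (a + b) + c                         ≡⟨ cong (λ z → suc m * z + c) (nCk+nC[k+1]≡[n+1]C[k+1] m k) ⟩
    suc m * c + c                               ≡⟨ +-comm (suc m * c) c ⟩
    suc (suc m) * c                             ∎
    where
    open ≡-Reasoning
    a = m C k
    b = m C suc k
    c = suc m C suc k
    d = suc m C suc (suc k)

  [n+1]*[2n]C[n+1]≡n*[2n]Cn : ∀ n → suc n * ((2 * n) C suc n) ≡ n * ((2 * n) C n)
  [n+1]*[2n]C[n+1]≡n*[2n]Cn n = +-cancelˡ-≡ (suc n * x) _ _ (begin
    suc n * x + suc n * y        ≡⟨ *-distribˡ-+ (suc n) x y ⟨
    suc n * (x + y)              ≡⟨ cong (suc n *_) (nCk+nC[k+1]≡[n+1]C[k+1] (2 * n) n) ⟩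
    suc n * (suc (2 * n) C suc n) ≡⟨ [k+1]*[m+1]C[k+1]≡[m+1]*mCk (2 * n) n ⟩
    suc (2 * n) * x              ≡⟨ solve 2 (λ n x → (con 1 :+ con 2 :* n) :* x := (con 1 :+ n) :* x :+ n :* x) refl n x ⟩
    suc n * x + n * x            ∎)
    where
    open ≡-Reasoning
    x = (2 * n) C n
    y = (2 * n) C suc n

  -- The Catalan number is the ballot difference C(2n,n) - C(2n,n+1), so the division is exact.
  [n+1]*catalan≡[2n]Cn : ∀ n → suc n * catalan n ≡ (2 * n) C n
  [n+1]*catalan≡[2n]Cn n = trans (cong (suc n *_) catalan≡q) [n+1]*q≡x
    where
    open ≡-Reasoning
    x = (2 * n) C n
    y = (2 * n) C suc n
    q = x ∸ y
    [n+1]*q≡x : suc n * q ≡ x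
    [n+1]*q≡x = begin
      suc n * (x ∸ y)          ≡⟨ *-distribˡ-∸ (suc n) x y ⟩
      suc n * x ∸ suc n * y    ≡⟨ cong (suc n * x ∸_) ([n+1]*[2n]C[n+1]≡n*[2n]Cn n) ⟩
      (x + n * x) ∸ n * x      ≡⟨ m+n∸n≡m x (n * x) ⟩
      x                        ∎
    catalan≡q : catalan n ≡ q
    catalan≡q = begin
      x / suc n                ≡⟨ cong (_/ suc n) [n+1]*q≡x ⟨
      (suc n * q) / suc n      ≡⟨ cong (_/ suc n) (*-comm (suc n) q) ⟩
      (q * suc n) / suc n      ≡⟨ m*n/n≡m q (suc n) ⟩
      q                        ∎

  [2n+1]Cn≡[2n+1]C[n+1] : ∀ n → suc (2 * n) C n ≡ suc (2 * n) C suc n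
  [2n+1]Cn≡[2n+1]C[n+1] n = begin
    suc (2 * n) C n            ≡⟨ cong (_C n) 2n+1≡n+[n+1] ⟩
    (n + suc n) C n            ≡⟨ nCk≡nC[n∸k] (m≤m+n n (suc n)) ⟩
    (n + suc n) C (n + suc n ∸ n) ≡⟨ cong ((n + suc n) C_) (m+n∸m≡n n (suc n)) ⟩
    (n + suc n) C suc n        ≡⟨ cong (_C suc n) 2n+1≡n+[n+1] ⟨
    suc (2 * n) C suc n        ∎
    where
    open ≡-Reasoning
    2n+1≡n+[n+1] : suc (2 * n) ≡ n + suc n
    2n+1≡n+[n+1] = solve 1 (λ n → con 1 :+ con 2 :* n := n :+ (con 1 :+ n)) refl n

  catalan-recurrence : ∀ n → (2 + n) * catalan (suc n) ≡ (2 + 4 * n) * catalan n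
  catalan-recurrence n = *-cancelˡ-≡ _ _ (suc n) (begin
    suc n * ((2 + n) * catalan (suc n))             ≡⟨ cong (suc n *_) ([n+1]*catalan≡[2n]Cn (suc n)) ⟩
    suc n * ((2 * suc n) C suc n)                   ≡⟨ cong (λ z → suc n * (z C suc n)) (*-suc 2 n) ⟩
    suc n * (suc (suc (2 * n)) C suc n)             ≡⟨ cong (suc n *_) (nCk+nC[k+1]≡[n+1]C[k+1] (suc (2 * n)) n) ⟨
    suc n * (suc (2 * n) C n + w)                   ≡⟨ cong (λ z → suc n * (z + w)) ([2n+1]Cn≡[2n+1]C[n+1] n) ⟩
    suc n * (w + w)                                 ≡⟨ solve 2 (λ a w → a :* (w :+ w) := con 2 :* (a :* w)) refl (suc n) w ⟩
    2 * (suc n * w)                                 ≡⟨ cong (2 *_) ([k+1]*[m+1]C[k+1]≡[m+1]*mCk (2 * n) n) ⟩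
    2 * (suc (2 * n) * ((2 * n) C n))               ≡⟨ cong (λ z → 2 * (suc (2 * n) * z)) ([n+1]*catalan≡[2n]Cn n) ⟨
    2 * (suc (2 * n) * (suc n * catalan n))         ≡⟨ solve 2 (λ n c → con 2 :* ((con 1 :+ con 2 :* n) :* ((con 1 :+ n) :* c))
                                                                   := (con 1 :+ n) :* ((con 2 :+ con 4 :* n) :* c)) refl n (catalan n) ⟩
    suc n * ((2 + 4 * n) * catalan n)               ∎)
    where
    open ≡-Reasoning
    w = suc (2 * n) C suc n

  catalan-unique : (u : ℕ → ℕ) → u 0 ≡ 1 → (∀ n → (2 + n) * u (suc n) ≡ (2 + 4 * n) * u n) → ∀ n → u n ≡ catalan n
  catalan-unique u u0 rec zero    = u0
  catalan-unique u u0 rec (suc n) = *-cancelˡ-≡ _ _ (2 + n)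
    (trans (rec n) (trans (cong ((2 + 4 * n) *_) (catalan-unique u u0 rec n)) (sym (catalan-recurrence n))))

module CatalanSeries where

  open PowerSeries
  open CatalanNumbers using (catalan-unique)
  open import Data.Nat as ℕ using (ℕ; suc)
  open import Data.Integer using (+_; -_; _+_; _*_)
  import Data.Integer.Properties as ℤP
  open import Data.Integer.Solver using (module +-*-Solver)
  open import Relation.Binary.PropositionalEquality
  open import Relation.Binary.Reasoning.Setoid fps-setoid as ≈-Reasoning using ()

  -- Differentiating A = 1 + x A² and eliminating A² gives (1 - 4x) θA = 1 - A + 2xA,
  -- i.e. the first-order recurrence of the Catalan numbers.
  module _ (A : FPS) (A-eq : A ≈ one ⊕ X ⊛ (A ⊛ A)) where

    private
      A-eq₁ : A ≈ cst (+ 1) ⊕ X ⊛ (A ⊛ A)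
      A-eq₁ = mk≈ (λ n → trans (coeff A-eq n) (cong (_+ (X ⊛ (A ⊛ A)) n) (sym (cst-1 n))))

    θ-functional-equation : θ A ≈ X ⊛ (A ⊛ A) ⊕ X ⊛ (θ A ⊛ A ⊕ A ⊛ θ A)
    θ-functional-equation = begin
      θ A                                              ≈⟨ θ-cong A-eq ⟩
      θ (one ⊕ X ⊛ (A ⊛ A))                            ≈⟨ θ-⊕ one (X ⊛ (A ⊛ A)) ⟩
      θ one ⊕ θ (X ⊛ (A ⊛ A))                          ≈⟨ ⊕-cong θ-one (θ-⊛ X (A ⊛ A)) ⟩
      0ₛ ⊕ (θ X ⊛ (A ⊛ A) ⊕ X ⊛ θ (A ⊛ A))             ≈⟨ ⊕-identityˡ _ ⟩
      θ X ⊛ (A ⊛ A) ⊕ X ⊛ θ (A ⊛ A)                    ≈⟨ ⊕-cong (⊛-cong≈ θ-X (≈-refl {A ⊛ A})) (⊛-cong≈ (≈-refl {X}) (θ-⊛ A A)) ⟩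
      X ⊛ (A ⊛ A) ⊕ X ⊛ (θ A ⊛ A ⊕ A ⊛ θ A)            ∎
      where open ≈-Reasoning

    euler-equation : θ A ⊕ neg (cst (+ 4) ⊛ (X ⊛ θ A)) ≈ cst (+ 1) ⊕ neg A ⊕ cst (+ 2) ⊛ (X ⊛ A)
    euler-equation = linear-combination
      (cst (+ 1) ⊕ neg (cst (+ 2) ⊛ (X ⊛ A)))
      (cst (+ 4) ⊛ (X ⊛ θ A) ⊕ cst (+ 1) ⊕ cst (+ 2) ⊛ (X ⊛ A))
      (identity X A (θ A)) θ-functional-equation A-eq₁
      where
      open FPS-Solver
      identity : ∀ X A T → T ⊕ neg (cst (+ 4) ⊛ (X ⊛ T)) ≈
        (cst (+ 1) ⊕ neg A ⊕ cst (+ 2) ⊛ (X ⊛ A))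
        ⊕ (cst (+ 1) ⊕ neg (cst (+ 2) ⊛ (X ⊛ A))) ⊛ (T ⊕ neg (X ⊛ (A ⊛ A) ⊕ X ⊛ (T ⊛ A ⊕ A ⊛ T)))
        ⊕ (cst (+ 4) ⊛ (X ⊛ T) ⊕ cst (+ 1) ⊕ cst (+ 2) ⊛ (X ⊛ A)) ⊛ (A ⊕ neg (cst (+ 1) ⊕ X ⊛ (A ⊛ A)))
      identity = solve 3 (λ X A T → T :- con (+ 4) :* (X :* T) :=
        (con (+ 1) :- A :+ con (+ 2) :* (X :* A))
        :+ (con (+ 1) :- con (+ 2) :* (X :* A)) :* (T :- (X :* (A :* A) :+ X :* (T :* A :+ A :* T)))
        :+ (con (+ 4) :* (X :* T) :+ con (+ 1) :+ con (+ 2) :* (X :* A)) :* (A :- (con (+ 1) :+ X :* (A :* A)))) ≈-refl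

    euler-coefficient : ∀ n → + suc n * A (suc n) + - (+ 4 * (+ n * A n)) ≡ + 0 + - A (suc n) + + 2 * A n
    euler-coefficient n = begin
      + suc n * A (suc n) + - (+ 4 * (+ n * A n))
        ≡⟨ cong (λ z → + suc n * A (suc n) + - z) (trans (cst-⊛ (+ 4) (X ⊛ θ A) (suc n)) (cong (+ 4 *_) (X⊛-suc (θ A) n))) ⟨
      (θ A ⊕ neg (cst (+ 4) ⊛ (X ⊛ θ A))) (suc n)
        ≡⟨ coeff euler-equation (suc n) ⟩
      + 0 + - A (suc n) + (cst (+ 2) ⊛ (X ⊛ A)) (suc n)
        ≡⟨ cong (λ z → + 0 + - A (suc n) + z) (trans (cst-⊛ (+ 2) (X ⊛ A) (suc n)) (cong (+ 2 *_) (X⊛-suc A n))) ⟩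
      + 0 + - A (suc n) + + 2 * A n
        ∎
      where open ≡-Reasoning

  functional-equation⇒catalan : (a : ℕ → ℕ) → ofℕ a ≈ one ⊕ X ⊛ (ofℕ a ⊛ ofℕ a) → ∀ n → a n ≡ catalan n
  functional-equation⇒catalan a a-eq = catalan-unique a (ℤP.+-injective (coeff a-eq 0)) recurrence
    where
    open +-*-Solver
    recurrenceℤ : ∀ n → (+ 2 + + n) * + a (suc n) ≡ (+ 2 + + 4 * + n) * + a n
    recurrenceℤ n = begin
      (+ 2 + + n) * B
        ≡⟨ solve 3 (λ N B C → (con (+ 2) :+ N) :* B := ((con (+ 1) :+ N) :* B :- con (+ 4) :* (N :* C)) :+ B :+ con (+ 4) :* (N :* C)) refl (+ n) B C ⟩
      (+ suc n * B + - (+ 4 * (+ n * C))) + B + + 4 * (+ n * C)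
        ≡⟨ cong (λ z → z + B + + 4 * (+ n * C)) (euler-coefficient (ofℕ a) a-eq n) ⟩
      (+ 0 + - B + + 2 * C) + B + + 4 * (+ n * C)
        ≡⟨ solve 3 (λ N B C → (con (+ 0) :- B :+ con (+ 2) :* C) :+ B :+ con (+ 4) :* (N :* C) := (con (+ 2) :+ con (+ 4) :* N) :* C) refl (+ n) B C ⟩
      (+ 2 + + 4 * + n) * C
        ∎
      where
      open ≡-Reasoning
      B = + a (suc n)
      C = + a n
    recurrence : ∀ n → (2 ℕ.+ n) ℕ.* a (suc n) ≡ (2 ℕ.+ 4 ℕ.* n) ℕ.* a n
    recurrence n = ℤP.+-injective (begin
      + ((2 ℕ.+ n) ℕ.* a (suc n))        ≡⟨ ℤP.pos-* (2 ℕ.+ n) (a (suc n)) ⟩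
      (+ 2 + + n) * + a (suc n)          ≡⟨ recurrenceℤ n ⟩
      (+ 2 + + 4 * + n) * + a n          ≡⟨ cong (λ z → (+ 2 + z) * + a n) (ℤP.pos-* 4 n) ⟨
      + (2 ℕ.+ 4 ℕ.* n) * + a n          ≡⟨ ℤP.pos-* (2 ℕ.+ 4 ℕ.* n) (a n) ⟨
      + ((2 ℕ.+ 4 ℕ.* n) ℕ.* a n)        ∎)
      where open ≡-Reasoning

  weighted-catalan-identity : ∀ {C H} → C ≈ one ⊕ X ⊛ (C ⊛ C) →
    H ≈ X ⊛ (C ⊛ H ⊕ H ⊛ C ⊕ (C ⊕ θ C) ⊛ θ C ⊕ θ C) →
    (one ⊖ scale (+ 2) (X ⊛ C)) ⊛ H ≈
      X ⊛ ((X ⊛ deriv C ⊖ C ⊕ one) ⊛ (X ⊛ deriv C ⊕ scale (+ 2) C)) ⊕ scale (+ 2) (C ⊖ one ⊖ X ⊛ C)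
  -- Left minus right side is (H - x(⋯)) - 2(C - 1 - xC²).
  weighted-catalan-identity {C} {H} C-eq H-eq = begin
    (one ⊖ scale (+ 2) (X ⊛ C)) ⊛ H
      ≈⟨ ⊛-cong≈ (⊕-cong (≈-sym 1≈one) (neg-cong (≈-sym (mk≈ (cst-⊛ (+ 2) (X ⊛ C)))))) (≈-refl {H}) ⟩
    (cst (+ 1) ⊕ neg (cst (+ 2) ⊛ (X ⊛ C))) ⊛ H
      ≈⟨ linear-combination (cst (+ 1)) (cst (- + 2)) (identity X C H (θ C)) H-eq C-eq₁ ⟩
    X ⊛ ((θ C ⊕ neg C ⊕ cst (+ 1)) ⊛ (θ C ⊕ cst (+ 2) ⊛ C)) ⊕ cst (+ 2) ⊛ (C ⊕ neg (cst (+ 1)) ⊕ neg (X ⊛ C))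
      ≈⟨ ⊕-cong (⊛-cong≈ (≈-refl {X}) (⊛-cong≈ (⊕-cong (⊕-cong (≈-sym (X⊛deriv C)) (≈-refl {neg C})) 1≈one)
                                               (⊕-cong (≈-sym (X⊛deriv C)) (mk≈ (cst-⊛ (+ 2) C)))))
                (≈-trans (mk≈ (cst-⊛ (+ 2) _)) (mk≈ λ n → cong (λ z → + 2 * (C n + - z + - (X ⊛ C) n)) (cst-1 n))) ⟩
    X ⊛ ((X ⊛ deriv C ⊖ C ⊕ one) ⊛ (X ⊛ deriv C ⊕ scale (+ 2) C)) ⊕ scale (+ 2) (C ⊖ one ⊖ X ⊛ C)
      ∎
    where
    open ≈-Reasoning
    open FPS-Solver
    1≈one : cst (+ 1) ≈ one
    1≈one = mk≈ cst-1
    C-eq₁ : C ≈ cst (+ 1) ⊕ X ⊛ (C ⊛ C)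
    C-eq₁ = ≈-trans C-eq (⊕-cong (≈-sym 1≈one) (≈-refl {X ⊛ (C ⊛ C)}))
    identity : ∀ X A H T → (cst (+ 1) ⊕ neg (cst (+ 2) ⊛ (X ⊛ A))) ⊛ H ≈
      (X ⊛ ((T ⊕ neg A ⊕ cst (+ 1)) ⊛ (T ⊕ cst (+ 2) ⊛ A)) ⊕ cst (+ 2) ⊛ (A ⊕ neg (cst (+ 1)) ⊕ neg (X ⊛ A)))
      ⊕ cst (+ 1) ⊛ (H ⊕ neg (X ⊛ (A ⊛ H ⊕ H ⊛ A ⊕ (A ⊕ T) ⊛ T ⊕ T)))
      ⊕ cst (- + 2) ⊛ (A ⊕ neg (cst (+ 1) ⊕ X ⊛ (A ⊛ A)))
    identity = solve 4 (λ X A H T → (con (+ 1) :- con (+ 2) :* (X :* A)) :* H :=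
      (X :* ((T :- A :+ con (+ 1)) :* (T :+ con (+ 2) :* A)) :+ con (+ 2) :* (A :- con (+ 1) :- X :* A))
      :+ con (+ 1) :* (H :- X :* (A :* H :+ H :* A :+ (A :+ T) :* T :+ T))
      :+ con (- + 2) :* (A :- (con (+ 1) :+ X :* (A :* A)))) ≈-refl

module Patterns where

  open import Data.List using (List; []; _∷_; _++_; map)
  open import Data.List.Relation.Unary.Any using (here; there)
  open import Data.List.Membership.Propositional using (_∈_)
  open import Data.List.Membership.Propositional.Properties using (∈-++⁻; ∈-++⁺ˡ; ∈-map⁺; ∈-map⁻)
  open import Data.Nat using (ℕ; _<_)
  open import Data.Nat.Properties using (<-asym)
  open import Data.Product using (_×_; _,_; ∃)
  open import Data.Sum using (_⊎_; inj₁; inj₂)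
  open import Data.Empty using (⊥)
  open import Relation.Binary.PropositionalEquality using (_≡_; refl)

  data Occurs₂ (b c : ℕ) : List ℕ → Set where
    here  : ∀ {xs} → c ∈ xs → Occurs₂ b c (b ∷ xs)
    there : ∀ {x xs} → Occurs₂ b c xs → Occurs₂ b c (x ∷ xs)

  data Occurs₃ (a b c : ℕ) : List ℕ → Set where
    here  : ∀ {xs} → Occurs₂ b c xs → Occurs₃ a b c (a ∷ xs)
    there : ∀ {x xs} → Occurs₃ a b c xs → Occurs₃ a b c (x ∷ xs)

  Avoids213ᴸ : List ℕ → Set
  Avoids213ᴸ xs = ∀ {a b c} → Occurs₃ a b c xs → b < a → a < c → ⊥

  occurs₂⇒∈ : ∀ {b c xs} → Occurs₂ b c xs → c ∈ xs
  occurs₂⇒∈ (here c∈)  = there c∈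
  occurs₂⇒∈ (there oc) = there (occurs₂⇒∈ oc)

  occurs₂-++⁺ˡ : ∀ {b c} xs {ys} → Occurs₂ b c xs → Occurs₂ b c (xs ++ ys)
  occurs₂-++⁺ˡ (_ ∷ xs) (here c∈)  = here (∈-++⁺ˡ c∈)
  occurs₂-++⁺ˡ (_ ∷ xs) (there oc) = there (occurs₂-++⁺ˡ xs oc)

  occurs₃-++⁺ˡ : ∀ {a b c} xs {ys} → Occurs₃ a b c xs → Occurs₃ a b c (xs ++ ys)
  occurs₃-++⁺ˡ (_ ∷ xs) (here oc)  = here (occurs₂-++⁺ˡ xs oc)
  occurs₃-++⁺ˡ (_ ∷ xs) (there oc) = there (occurs₃-++⁺ˡ xs oc)

  occurs₃-++⁺ʳ : ∀ {a b c} xs {ys} → Occurs₃ a b c ys → Occurs₃ a b c (xs ++ ys)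
  occurs₃-++⁺ʳ []       oc = oc
  occurs₃-++⁺ʳ (_ ∷ xs) oc = there (occurs₃-++⁺ʳ xs oc)

  occurs₃-middle : ∀ {a b c} xs {ys} → a ∈ xs → c ∈ ys → Occurs₃ a b c (xs ++ b ∷ ys)
  occurs₃-middle (_ ∷ xs) (here refl) c∈ = here (middle xs)
    where
    middle : ∀ zs → Occurs₂ _ _ (zs ++ _ ∷ _)
    middle []       = here c∈
    middle (_ ∷ zs) = there (middle zs)
  occurs₃-middle (_ ∷ xs) (there a∈) c∈ = there (occurs₃-middle xs a∈ c∈)

  occurs₂-++⁻ : ∀ {b c} xs {ys} → Occurs₂ b c (xs ++ ys) → Occurs₂ b c xs ⊎ c ∈ ys
  occurs₂-++⁻ []       oc = inj₂ (occurs₂⇒∈ oc)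
  occurs₂-++⁻ (_ ∷ xs) (here c∈) with ∈-++⁻ xs c∈
  ... | inj₁ c∈xs = inj₁ (here c∈xs)
  ... | inj₂ c∈ys = inj₂ c∈ys
  occurs₂-++⁻ (_ ∷ xs) (there oc) with occurs₂-++⁻ xs oc
  ... | inj₁ oc′  = inj₁ (there oc′)
  ... | inj₂ c∈ys = inj₂ c∈ys

  occurs₃-++⁻ : ∀ {a b c} xs {ys} → Occurs₃ a b c (xs ++ ys) →
    Occurs₃ a b c xs ⊎ (a ∈ xs × c ∈ ys) ⊎ Occurs₃ a b c ys
  occurs₃-++⁻ []       oc = inj₂ (inj₂ oc)
  occurs₃-++⁻ (_ ∷ xs) (here oc) with occurs₂-++⁻ xs oc
  ... | inj₁ oc′  = inj₁ (here oc′)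
  ... | inj₂ c∈ys = inj₂ (inj₁ (here refl , c∈ys))
  occurs₃-++⁻ (_ ∷ xs) (there oc) with occurs₃-++⁻ xs oc
  ... | inj₁ oc′               = inj₁ (there oc′)
  ... | inj₂ (inj₁ (a∈ , c∈)) = inj₂ (inj₁ (there a∈ , c∈))
  ... | inj₂ (inj₂ oc′)        = inj₂ (inj₂ oc′)

  occurs₂-map⁺ : ∀ (f : ℕ → ℕ) {b c xs} → Occurs₂ b c xs → Occurs₂ (f b) (f c) (map f xs)
  occurs₂-map⁺ f (here c∈)  = here (∈-map⁺ f c∈)
  occurs₂-map⁺ f (there oc) = there (occurs₂-map⁺ f oc)

  occurs₃-map⁺ : ∀ (f : ℕ → ℕ) {a b c xs} → Occurs₃ a b c xs → Occurs₃ (f a) (f b) (f c) (map f xs)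
  occurs₃-map⁺ f (here oc)  = here (occurs₂-map⁺ f oc)
  occurs₃-map⁺ f (there oc) = there (occurs₃-map⁺ f oc)

  occurs₂-map⁻ : ∀ (f : ℕ → ℕ) {b′ c′} xs → Occurs₂ b′ c′ (map f xs) →
    ∃ λ b → ∃ λ c → Occurs₂ b c xs × b′ ≡ f b × c′ ≡ f c
  occurs₂-map⁻ f (x ∷ xs) (here c∈) with ∈-map⁻ f c∈
  ... | c , c∈xs , refl = x , c , here c∈xs , refl , refl
  occurs₂-map⁻ f (x ∷ xs) (there oc) with occurs₂-map⁻ f xs oc
  ... | b , c , oc′ , refl , refl = b , c , there oc′ , refl , refl

  occurs₃-map⁻ : ∀ (f : ℕ → ℕ) {a′ b′ c′} xs → Occurs₃ a′ b′ c′ (map f xs) →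
    ∃ λ a → ∃ λ b → ∃ λ c → Occurs₃ a b c xs × a′ ≡ f a × b′ ≡ f b × c′ ≡ f c
  occurs₃-map⁻ f (x ∷ xs) (here oc) with occurs₂-map⁻ f xs oc
  ... | b , c , oc′ , refl , refl = x , b , c , here oc′ , refl , refl , refl
  occurs₃-map⁻ f (x ∷ xs) (there oc) with occurs₃-map⁻ f xs oc
  ... | a , b , c , oc′ , refl , refl , refl = a , b , c , there oc′ , refl , refl , refl

  avoids-++⁻ˡ : ∀ xs {ys} → Avoids213ᴸ (xs ++ ys) → Avoids213ᴸ xs
  avoids-++⁻ˡ xs av oc = av (occurs₃-++⁺ˡ xs oc)

  avoids-++⁻ʳ : ∀ xs {ys} → Avoids213ᴸ (xs ++ ys) → Avoids213ᴸ ys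
  avoids-++⁻ʳ xs av oc = av (occurs₃-++⁺ʳ xs oc)

  avoids-∷⁻ : ∀ {x xs} → Avoids213ᴸ (x ∷ xs) → Avoids213ᴸ xs
  avoids-∷⁻ av oc = av (there oc)

  -- In an occurrence of 213 the 0 cannot play the 2, and the 2 cannot precede the 0
  -- while the 3 follows it.
  avoids-++-0∷ : ∀ xs ys → Avoids213ᴸ xs → Avoids213ᴸ ys → (∀ {x y} → x ∈ xs → y ∈ 0 ∷ ys → y < x) →
    Avoids213ᴸ (xs ++ 0 ∷ ys)
  avoids-++-0∷ xs ys avx avy above oc b<a a<c with occurs₃-++⁻ xs oc
  ... | inj₁ oc′                = avx oc′ b<a a<c
  ... | inj₂ (inj₁ (a∈ , c∈))   = <-asym a<c (above a∈ c∈)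
  ... | inj₂ (inj₂ (there oc′)) = avy oc′ b<a a<c
  ... | inj₂ (inj₂ (here _))    with () ← b<a

  avoids-map⁺ : ∀ f {xs} → (∀ {x y} → f x < f y → x < y) → Avoids213ᴸ xs → Avoids213ᴸ (map f xs)
  avoids-map⁺ f {xs} reflects av oc b<a a<c with occurs₃-map⁻ f xs oc
  ... | _ , _ , _ , oc′ , refl , refl , refl = av oc′ (reflects b<a) (reflects a<c)

  avoids-map⁻ : ∀ f {xs} → (∀ {x y} → x < y → f x < f y) → Avoids213ᴸ (map f xs) → Avoids213ᴸ xs
  avoids-map⁻ f mono av oc b<a a<c = av (occurs₃-map⁺ f oc) (mono b<a) (mono a<c)

module UniqueLists {A : Set} where

  open import Data.List using (List; []; _∷_; _++_; concatMap)
  open import Data.List.Relation.Unary.Unique.Propositional using (Unique)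
  import Data.List.Relation.Unary.Unique.Propositional.Properties as Unique
  open import Data.List.Relation.Unary.AllPairs using ([]; _∷_)
  import Data.List.Relation.Unary.AllPairs as AllPairs
  import Data.List.Relation.Unary.AllPairs.Properties as AllPairs
  open import Data.List.Relation.Unary.All as All using (All; []; _∷_)
  import Data.List.Relation.Unary.All.Properties as All
  open import Data.List.Relation.Unary.Any using (here; there)
  open import Data.List.Membership.Propositional using (_∈_)
  open import Data.List.Membership.Propositional.Properties using (∈-∃++; ∈-++⁺ʳ)
  open import Data.List.Relation.Binary.Subset.Propositional using (_⊆_)
  open import Data.List.Relation.Binary.Disjoint.Propositional using (Disjoint)
  open import Data.List.Relation.Binary.Permutation.Propositional using (_↭_; ↭-sym; ↭-trans; prep; ↭⇒↭ₛ)
  open import Data.List.Relation.Binary.Permutation.Propositional.Properties using (shift; ∈-resp-↭)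
  open import Data.List.Relation.Binary.Permutation.Setoid.Properties using (Unique-resp-↭)
  open import Data.Product using (_×_; _,_)
  open import Relation.Binary.PropositionalEquality using (_≡_; refl; setoid)
  open import Data.Empty using (⊥-elim)

  Unique-++⁻ : ∀ (xs : List A) {ys} → Unique (xs ++ ys) → Unique xs × Unique ys × Disjoint xs ys
  Unique-++⁻ []       u = [] , u , λ ()
  Unique-++⁻ (x ∷ xs) (x∉ ∷ u) with Unique-++⁻ xs u
  ... | uxs , uys , disjoint = All.++⁻ˡ xs x∉ ∷ uxs , uys , λ where
    (here refl , z∈ys)  → All.lookup x∉ (∈-++⁺ʳ xs z∈ys) refl
    (there z∈xs , z∈ys) → disjoint (z∈xs , z∈ys)

  Unique-concatMap⁺ : ∀ {B : Set} (f : B → List A) {xs} → Unique xs → (∀ x → Unique (f x)) →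
    (∀ {x y z} → z ∈ f x → z ∈ f y → x ≡ y) → Unique (concatMap f xs)
  Unique-concatMap⁺ f {xs} uxs uf same =
    Unique.concat⁺ (All.map⁺ (All.universal uf xs))
                   (AllPairs.map⁺ (AllPairs.map (λ x≢y {_} (z∈fx , z∈fy) → x≢y (same z∈fx z∈fy)) uxs))

  Unique∧⊆∧⊇⇒↭ : ∀ {xs ys : List A} → Unique xs → Unique ys → xs ⊆ ys → ys ⊆ xs → xs ↭ ys
  Unique∧⊆∧⊇⇒↭ {[]}     {[]}    _ _ _ _ = _↭_.refl
  Unique∧⊆∧⊇⇒↭ {[]}     {_ ∷ _} _ _ _ ys⊆xs with () ← ys⊆xs (here refl)
  Unique∧⊆∧⊇⇒↭ {x ∷ xs} (x∉xs ∷ uxs) uys xs⊆ys ys⊆xs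
    with ys₁ , ys₂ , refl ← ∈-∃++ (xs⊆ys (here refl)) =
    ↭-trans (prep x (Unique∧⊆∧⊇⇒↭ uxs uzs tail⊆ tail⊇)) (↭-sym ys↭)
    where
    ys↭ = shift x ys₁ ys₂
    unique-x∷zs : Unique (x ∷ ys₁ ++ ys₂)
    unique-x∷zs = Unique-resp-↭ (setoid A) (↭⇒↭ₛ ys↭) uys
    uzs = AllPairs.tail unique-x∷zs
    tail⊆ : xs ⊆ ys₁ ++ ys₂
    tail⊆ z∈xs with ∈-resp-↭ ys↭ (xs⊆ys (there z∈xs))
    ... | here refl = ⊥-elim (All.lookup x∉xs z∈xs refl)
    ... | there z∈  = z∈
    tail⊇ : ys₁ ++ ys₂ ⊆ xs
    tail⊇ z∈zs with ys⊆xs (∈-resp-↭ (↭-sym ys↭) (there z∈zs))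
    ... | here refl = ⊥-elim (All.lookup (AllPairs.head unique-x∷zs) z∈zs refl)
    ... | there z∈  = z∈

module Arrangements where

  open Patterns
  open UniqueLists
  open import Data.Nat
  open import Data.Nat.Properties
  open import Data.List using (List; _∷_; _++_; map; length)
  open import Data.List.Properties using (map-∘; map-id-local; length-upTo)
  open import Data.List.Extrema.Nat using (min; min≤⊤; min≤xs; v<min⁺)
  open import Data.List.Relation.Unary.Unique.Propositional using (Unique)
  import Data.List.Relation.Unary.Unique.Propositional.Properties as Unique
  open import Data.List.Relation.Unary.AllPairs as AllPairs using (_∷_)
  open import Data.List.Relation.Unary.All as All using (All)
  open import Data.List.Relation.Unary.Any using (here; there)
  open import Data.List.Membership.Propositional using (_∈_)
  open import Data.List.Membership.Propositional.Properties
    using (∈-++⁻; ∈-++⁺ˡ; ∈-++⁺ʳ; ∈-map⁺; ∈-map⁻; ∈-upTo⁺; ∈-upTo⁻)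
  open import Data.List.Relation.Binary.Permutation.Propositional.Properties using (↭-length)
  open import Data.Product using (_×_; _,_; proj₁; proj₂; ∃)
  open import Data.Sum using (_⊎_; inj₁; inj₂)
  open import Data.Empty using (⊥-elim)
  open import Relation.Nullary using (yes; no)
  open import Relation.Binary.Definitions using (tri<; tri≈; tri>)
  open import Data.List.Relation.Binary.Disjoint.Propositional using (Disjoint)
  open import Relation.Binary.PropositionalEquality

  record IsAv213 (lo hi : ℕ) (ℓ : List ℕ) : Set where
    field
      unique   : Unique ℓ
      bounded  : ∀ {v} → v ∈ ℓ → lo ≤ v × v < hi
      complete : ∀ {v} → lo ≤ v → v < hi → v ∈ ℓ
      avoids   : Avoids213ᴸ ℓ

  IsAv213-length : ∀ {n ℓ} → IsAv213 0 n ℓ → length ℓ ≡ n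
  IsAv213-length {n} av = trans (↭-length ℓ↭upTo) (length-upTo n)
    where
    open IsAv213 av
    ℓ↭upTo = Unique∧⊆∧⊇⇒↭ unique (Unique.upTo⁺ n) (λ v∈ → ∈-upTo⁺ (proj₂ (bounded v∈))) (λ v∈ → complete z≤n (∈-upTo⁻ v∈))

  shift : ℕ → List ℕ → List ℕ
  shift k = map (k +_)

  IsAv213-shift : ∀ k {n α} → IsAv213 0 n α → IsAv213 k (k + n) (shift k α)
  IsAv213-shift k {n} {α} av = record
    { unique   = Unique.map⁺ (+-cancelˡ-≡ k _ _) unique
    ; bounded  = bounded′
    ; complete = λ {v} k≤v v<k+n →
        subst (_∈ shift k α) (m+[n∸m]≡n k≤v) (∈-map⁺ (k +_) (complete z≤n (subst (v ∸ k <_) (m+n∸m≡n k n) (∸-monoˡ-< v<k+n k≤v))))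
    ; avoids   = avoids-map⁺ (k +_) (+-cancelˡ-< k _ _) avoids
    }
    where
    open IsAv213 av
    bounded′ : ∀ {v} → v ∈ shift k α → k ≤ v × v < k + n
    bounded′ v∈ with a , a∈ , refl ← ∈-map⁻ (k +_) v∈ = m≤m+n k a , +-monoʳ-< k (proj₂ (bounded a∈))

  IsAv213-unshift : ∀ k {n ℓ} → IsAv213 k (k + n) ℓ → ∃ λ α → ℓ ≡ shift k α × IsAv213 0 n α
  IsAv213-unshift k {n} {ℓ} av = α , ℓ≡ , record
    { unique   = Unique.map⁻ (subst Unique ℓ≡ unique)
    ; bounded  = λ a∈ → z≤n , +-cancelˡ-< k _ _ (proj₂ (bounded (in-ℓ a∈)))
    ; complete = complete′
    ; avoids   = avoids-map⁻ (k +_) (+-monoʳ-< k) (subst Avoids213ᴸ ℓ≡ avoids)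
    }
    where
    open IsAv213 av
    α = map (_∸ k) ℓ
    ℓ≡ : ℓ ≡ shift k α
    ℓ≡ = sym (trans (sym (map-∘ ℓ)) (map-id-local (All.tabulate (λ v∈ → m+[n∸m]≡n (proj₁ (bounded v∈))))))
    in-ℓ : ∀ {a} → a ∈ α → k + a ∈ ℓ
    in-ℓ a∈ = subst (_ ∈_) (sym ℓ≡) (∈-map⁺ (k +_) a∈)
    complete′ : ∀ {v} → 0 ≤ v → v < n → v ∈ α
    complete′ _ v<n with a , a∈ , k+v≡k+a ← ∈-map⁻ (k +_) (subst (_ ∈_) ℓ≡ (complete (m≤m+n k _) (+-monoʳ-< k v<n)))
      = subst (_∈ α) (sym (+-cancelˡ-≡ k _ _ k+v≡k+a)) a∈

  IsAv213-++-0∷ : ∀ {t hi A B} → 0 < t → t ≤ hi → IsAv213 t hi A → IsAv213 1 t B → IsAv213 0 hi (A ++ 0 ∷ B)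
  IsAv213-++-0∷ {t} {hi} {A} {B} 0<t t≤hi avA avB = record
    { unique   = Unique.++⁺ A.unique (All.tabulate (λ v∈ 0≡v → <-irrefl 0≡v (proj₁ (B.bounded v∈))) ∷ B.unique)
                   (λ (v∈A , v∈0B) → <⇒≱ (below v∈0B) (proj₁ (A.bounded v∈A)))
    ; bounded  = bounded
    ; complete = complete
    ; avoids   = avoids-++-0∷ A B A.avoids B.avoids (λ a∈ b∈ → <-≤-trans (below b∈) (proj₁ (A.bounded a∈)))
    }
    where
    module A = IsAv213 avA
    module B = IsAv213 avB
    below : ∀ {v} → v ∈ 0 ∷ B → v < t
    below (here refl) = 0<t
    below (there v∈)  = proj₂ (B.bounded v∈)
    bounded : ∀ {v} → v ∈ A ++ 0 ∷ B → 0 ≤ v × v < hi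
    bounded v∈ with ∈-++⁻ A v∈
    ... | inj₁ v∈A  = z≤n , proj₂ (A.bounded v∈A)
    ... | inj₂ v∈0B = z≤n , <-≤-trans (below v∈0B) t≤hi
    complete : ∀ {v} → 0 ≤ v → v < hi → v ∈ A ++ 0 ∷ B
    complete {zero}  _ _ = ∈-++⁺ʳ A (here refl)
    complete {suc v} _ v<hi with suc v <? t
    ... | yes v<t = ∈-++⁺ʳ A (there (B.complete (s≤s z≤n) v<t))
    ... | no  v≮t = ∈-++⁺ˡ (A.complete (≮⇒≥ v≮t) v<hi)

  module SplitAtZero {m} A B (av : IsAv213 0 (suc m) (A ++ 0 ∷ B)) where

    open IsAv213 av

    private
      parts = Unique-++⁻ A unique
      disjoint : Disjoint A (0 ∷ B)
      disjoint = proj₂ (proj₂ parts)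
      A-positive : ∀ {a} → a ∈ A → 0 < a
      A-positive a∈ = n≢0⇒n>0 λ { refl → disjoint (a∈ , here refl) }
      B-positive : ∀ {b} → b ∈ B → 0 < b
      B-positive b∈ with 0∉B ∷ _ ← proj₁ (proj₂ parts) = n≢0⇒n>0 λ { refl → All.lookup 0∉B b∈ refl }

    -- Otherwise a, 0, c would be an occurrence of 213.
    B<A : ∀ {a c} → a ∈ A → c ∈ B → c < a
    B<A {a} {c} a∈ c∈ with <-cmp c a
    ... | tri< c<a _ _ = c<a
    ... | tri≈ _ c≡a _ = ⊥-elim (disjoint (a∈ , there (subst (_∈ B) c≡a c∈)))
    ... | tri> _ _ a<c = ⊥-elim (avoids (occurs₃-middle A a∈ c∈) (A-positive a∈) a<c)

    t : ℕ
    t = min (suc m) A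

    0<t : 0 < t
    0<t = v<min⁺ (s≤s z≤n) (All.tabulate A-positive)

    t≤1+m : t ≤ suc m
    t≤1+m = min≤⊤ (suc m) A

    t≤A : ∀ {a} → a ∈ A → t ≤ a
    t≤A = All.lookup (min≤xs (suc m) A)

    B<t : ∀ {b} → b ∈ B → b < t
    B<t b∈ = v<min⁺ (proj₂ (bounded (∈-++⁺ʳ A (there b∈)))) (All.tabulate (λ a∈ → B<A a∈ b∈))

    left : IsAv213 t (suc m) A
    left = record
      { unique   = proj₁ parts
      ; bounded  = λ a∈ → t≤A a∈ , proj₂ (bounded (∈-++⁺ˡ a∈))
      ; complete = λ t≤v v<1+m → in-A t≤v (∈-++⁻ A (complete z≤n v<1+m))
      ; avoids   = avoids-++⁻ˡ A avoids
      }
      where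
      in-A : ∀ {v} → t ≤ v → v ∈ A ⊎ v ∈ 0 ∷ B → v ∈ A
      in-A _   (inj₁ v∈A)         = v∈A
      in-A t≤0 (inj₂ (here refl)) = ⊥-elim (<⇒≱ 0<t t≤0)
      in-A t≤v (inj₂ (there v∈B)) = ⊥-elim (<⇒≱ (B<t v∈B) t≤v)

    right : IsAv213 1 t B
    right = record
      { unique   = AllPairs.tail (proj₁ (proj₂ parts))
      ; bounded  = λ b∈ → B-positive b∈ , B<t b∈
      ; complete = λ 1≤v v<t → in-B 1≤v v<t (∈-++⁻ A (complete z≤n (<-≤-trans v<t t≤1+m)))
      ; avoids   = avoids-∷⁻ (avoids-++⁻ʳ A avoids)
      }
      where
      in-B : ∀ {v} → 1 ≤ v → v < t → v ∈ A ⊎ v ∈ 0 ∷ B → v ∈ B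
      in-B _ v<t (inj₁ v∈A)         = ⊥-elim (<⇒≱ v<t (t≤A v∈A))
      in-B () _  (inj₂ (here refl))
      in-B _ _   (inj₂ (there v∈B)) = v∈B

module Words where

  open Patterns
  open Arrangements using (IsAv213; IsAv213-length)
  open UniqueLists using (Unique-concatMap⁺)
  open import Data.Nat as ℕ using (ℕ; zero; suc; _<_; s≤s; z≤n)
  import Data.Nat.Properties as ℕ
  open import Data.Fin as Fin using (Fin; zero; suc; toℕ; fromℕ<; punchOut)
  import Data.Fin.Properties as Fin
  open import Data.Vec as Vec using (Vec; []; _∷_; lookup; toList)
  import Data.Vec.Properties as Vec
  open import Data.List using (List; []; _∷_; map; length; filter)
  import Data.List.Properties as List
  open import Data.List.Relation.Unary.Unique.Propositional using (Unique)
  import Data.List.Relation.Unary.Unique.Propositional.Properties as Unique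
  open import Data.List.Relation.Unary.AllPairs using ([]; _∷_)
  open import Data.List.Relation.Unary.All as All using (All; []; _∷_)
  import Data.List.Relation.Unary.All.Properties as All
  open import Data.List.Relation.Unary.Any as Any using (here; there)
  open import Data.List.Membership.Propositional using (_∈_; _∉_)
  open import Data.List.Membership.Propositional.Properties
  open import Data.Product using (_×_; _,_; proj₂; ∃; ∃₂)
  open import Data.Empty using (⊥-elim)
  open import Relation.Nullary using (yes; no)
  open import Relation.Binary.PropositionalEquality

  entries : ∀ {m k} → Vec (Fin m) k → List ℕ
  entries w = map toℕ (toList w)

  LookupInjective : ∀ {m k} → Vec (Fin m) k → Set
  LookupInjective {k = k} w = ∀ (i j : Fin k) → lookup w i ≡ lookup w j → i ≡ j

  entries-injective : ∀ {m k} {w w′ : Vec (Fin m) k} → entries w ≡ entries w′ → w ≡ w′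
  entries-injective {w = []}    {[]}     _  = refl
  entries-injective {w = _ ∷ _} {_ ∷ _} eq =
    cong₂ _∷_ (Fin.toℕ-injective (List.∷-injectiveˡ eq)) (entries-injective (List.∷-injectiveʳ eq))

  ∈-entries⁺ : ∀ {m k} (w : Vec (Fin m) k) i → toℕ (lookup w i) ∈ entries w
  ∈-entries⁺ (_ ∷ w) zero    = here refl
  ∈-entries⁺ (_ ∷ w) (suc i) = there (∈-entries⁺ w i)

  ∈-entries⁻ : ∀ {m k} (w : Vec (Fin m) k) {v} → v ∈ entries w → ∃ λ i → toℕ (lookup w i) ≡ v
  ∈-entries⁻ (_ ∷ w) (here refl) = zero , refl
  ∈-entries⁻ (_ ∷ w) (there v∈) with i , eq ← ∈-entries⁻ w v∈ = suc i , eq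

  entries-bounded : ∀ {m k} (w : Vec (Fin m) k) {v} → v ∈ entries w → v < m
  entries-bounded w v∈ with i , refl ← ∈-entries⁻ w v∈ = Fin.toℕ<n (lookup w i)

  LookupInjective⇒Unique : ∀ {m k} (w : Vec (Fin m) k) → LookupInjective w → Unique (entries w)
  LookupInjective⇒Unique []      _   = []
  LookupInjective⇒Unique (x ∷ w) inj =
    All.¬Any⇒All¬ (entries w) x∉w ∷ LookupInjective⇒Unique w (λ i j eq → Fin.suc-injective (inj (suc i) (suc j) eq))
    where
    x∉w : toℕ x ∉ entries w
    x∉w x∈ with i , eq ← ∈-entries⁻ w x∈ with () ← inj (suc i) zero (Fin.toℕ-injective eq)

  Unique⇒LookupInjective : ∀ {m k} (w : Vec (Fin m) k) → Unique (entries w) → LookupInjective w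
  Unique⇒LookupInjective (x ∷ w) (x∉ ∷ u) zero    zero    _  = refl
  Unique⇒LookupInjective (x ∷ w) (x∉ ∷ u) zero    (suc j) eq = ⊥-elim (All.lookup x∉ (∈-entries⁺ w j) (cong toℕ eq))
  Unique⇒LookupInjective (x ∷ w) (x∉ ∷ u) (suc i) zero    eq = ⊥-elim (All.lookup x∉ (∈-entries⁺ w i) (cong toℕ (sym eq)))
  Unique⇒LookupInjective (x ∷ w) (x∉ ∷ u) (suc i) (suc j) eq = cong suc (Unique⇒LookupInjective w u i j eq)

  -- A value missing from an injective word of length n over Fin n would give
  -- an injection Fin n → Fin (n - 1), via punchOut.
  LookupInjective⇒∈-entries : ∀ {n} (π : Vec (Fin n) n) → LookupInjective π → ∀ {v} → v < n → v ∈ entries π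
  LookupInjective⇒∈-entries {suc n} π inj {v} v<n with Fin.any? (λ i → lookup π i Fin.≟ fromℕ< v<n)
  ... | yes (i , eq) = subst (_∈ entries π) (trans (cong toℕ eq) (Fin.toℕ-fromℕ< v<n)) (∈-entries⁺ π i)
  ... | no ∄i = ⊥-elim (ℕ.1+n≰n (Fin.injective⇒≤ {f = squeeze} squeeze-injective))
    where
    misses : ∀ i → fromℕ< v<n ≢ lookup π i
    misses i eq = ∄i (i , sym eq)
    squeeze : Fin (suc n) → Fin n
    squeeze i = punchOut (misses i)
    squeeze-injective : ∀ {i j} → squeeze i ≡ squeeze j → i ≡ j
    squeeze-injective {i} {j} eq = inj i j (Fin.punchOut-injective (misses i) (misses j) eq)

  occurs₂-lookup : ∀ {m k} (w : Vec (Fin m) k) q r → q Fin.< r →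
    Occurs₂ (toℕ (lookup w q)) (toℕ (lookup w r)) (entries w)
  occurs₂-lookup (_ ∷ w) zero    (suc r) _         = here (∈-entries⁺ w r)
  occurs₂-lookup (_ ∷ w) (suc q) (suc r) (s≤s q<r) = there (occurs₂-lookup w q r q<r)

  occurs₃-lookup : ∀ {m k} (w : Vec (Fin m) k) p q r → p Fin.< q → q Fin.< r →
    Occurs₃ (toℕ (lookup w p)) (toℕ (lookup w q)) (toℕ (lookup w r)) (entries w)
  occurs₃-lookup (_ ∷ w) zero    (suc q) (suc r) _         (s≤s q<r) = here (occurs₂-lookup w q r q<r)
  occurs₃-lookup (_ ∷ w) (suc p) (suc q) (suc r) (s≤s p<q) (s≤s q<r) = there (occurs₃-lookup w p q r p<q q<r)

  occurs₂-lookup⁻ : ∀ {m k} (w : Vec (Fin m) k) {b c} → Occurs₂ b c (entries w) →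
    ∃₂ λ q r → q Fin.< r × toℕ (lookup w q) ≡ b × toℕ (lookup w r) ≡ c
  occurs₂-lookup⁻ (_ ∷ w) (here c∈) with r , eq ← ∈-entries⁻ w c∈ = zero , suc r , s≤s z≤n , refl , eq
  occurs₂-lookup⁻ (_ ∷ w) (there oc) with q , r , q<r , eq₁ , eq₂ ← occurs₂-lookup⁻ w oc =
    suc q , suc r , s≤s q<r , eq₁ , eq₂

  occurs₃-lookup⁻ : ∀ {m k} (w : Vec (Fin m) k) {a b c} → Occurs₃ a b c (entries w) →
    ∃₂ λ p q → ∃ λ r → p Fin.< q × q Fin.< r × toℕ (lookup w p) ≡ a × toℕ (lookup w q) ≡ b × toℕ (lookup w r) ≡ c
  occurs₃-lookup⁻ (_ ∷ w) (here oc) with q , r , q<r , eq₁ , eq₂ ← occurs₂-lookup⁻ w oc =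
    zero , suc q , suc r , s≤s z≤n , s≤s q<r , refl , eq₁ , eq₂
  occurs₃-lookup⁻ (_ ∷ w) (there oc) with p , q , r , p<q , q<r , eq₀ , eq₁ , eq₂ ← occurs₃-lookup⁻ w oc =
    suc p , suc q , suc r , s≤s p<q , s≤s q<r , eq₀ , eq₁ , eq₂

  Avoids213⇒Avoids213ᴸ : ∀ {n} (π : Word n) → Avoids213 π → Avoids213ᴸ (entries π)
  Avoids213⇒Avoids213ᴸ π av oc b<a a<c with p , q , r , p<q , q<r , refl , refl , refl ← occurs₃-lookup⁻ π oc =
    av p q r p<q q<r (b<a , a<c)

  Avoids213ᴸ⇒Avoids213 : ∀ {n} (π : Word n) → Avoids213ᴸ (entries π) → Avoids213 π
  Avoids213ᴸ⇒Avoids213 π av p q r p<q q<r (b<a , a<c) = av (occurs₃-lookup π p q r p<q q<r) b<a a<c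

  fromℕs : ∀ {m} (ℓ : List ℕ) → All (_< m) ℓ → Vec (Fin m) (length ℓ)
  fromℕs []      []          = []
  fromℕs (_ ∷ ℓ) (x<m ∷ ℓ<m) = fromℕ< x<m ∷ fromℕs ℓ ℓ<m

  entries-fromℕs : ∀ {m} (ℓ : List ℕ) (ℓ<m : All (_< m) ℓ) → entries (fromℕs ℓ ℓ<m) ≡ ℓ
  entries-fromℕs []      []          = refl
  entries-fromℕs (_ ∷ ℓ) (x<m ∷ ℓ<m) = cong₂ _∷_ (Fin.toℕ-fromℕ< x<m) (entries-fromℕs ℓ ℓ<m)

  fromEntries : ∀ {n} (ℓ : List ℕ) → All (_< n) ℓ → length ℓ ≡ n → ∃ λ (π : Word n) → entries π ≡ ℓ
  fromEntries ℓ ℓ<n refl = fromℕs ℓ ℓ<n , entries-fromℕs ℓ ℓ<n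

  ∈-allVecs : ∀ k n (w : Vec (Fin n) k) → w ∈ allVecs k n
  ∈-allVecs zero    n []      = here refl
  ∈-allVecs (suc k) n (x ∷ w) =
    ∈-concatMap⁺ (λ i → map (i ∷_) (allVecs k n))
                 (Any.map (λ { refl → ∈-map⁺ (x ∷_) (∈-allVecs k n w) }) (∈-allFin x))

  allVecs-unique : ∀ k n → Unique (allVecs k n)
  allVecs-unique zero    n = [] ∷ []
  allVecs-unique (suc k) n =
    Unique-concatMap⁺ (λ i → map (i ∷_) (allVecs k n)) (Unique.allFin⁺ n)
                      (λ i → Unique.map⁺ Vec.∷-injectiveʳ (allVecs-unique k n)) same-head
    where
    same-head : ∀ {x y w} → w ∈ map (x ∷_) (allVecs k n) → w ∈ map (y ∷_) (allVecs k n) → x ≡ y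
    same-head w∈x w∈y with _ , _ , refl ← ∈-map⁻ _ w∈x | _ , _ , eq ← ∈-map⁻ _ w∈y = Vec.∷-injectiveˡ eq

  Av213-unique : ∀ n → Unique (Av213 n)
  Av213-unique n = Unique.filter⁺ (λ π → avoids213? π) (Unique.filter⁺ (λ π → isPerm? π) (allVecs-unique n n))

  ∈-Av213⁻ : ∀ {n} {π : Word n} → π ∈ Av213 n → IsPerm π × Avoids213 π
  ∈-Av213⁻ {n} π∈ with π∈′ , av ← ∈-filter⁻ (λ π → avoids213? π) {xs = filter (λ π → isPerm? π) (allVecs n n)} π∈
                   with _ , perm ← ∈-filter⁻ (λ π → isPerm? π) {xs = allVecs n n} π∈′ = perm , av

  ∈-Av213⁺ : ∀ {n} {π : Word n} → IsPerm π → Avoids213 π → π ∈ Av213 n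
  ∈-Av213⁺ {n} {π} perm av =
    ∈-filter⁺ (λ π → avoids213? π) (∈-filter⁺ (λ π → isPerm? π) (∈-allVecs n n π) perm) av

  Av213ᴸ : ℕ → List (List ℕ)
  Av213ᴸ n = map entries (Av213 n)

  Av213ᴸ-unique : ∀ n → Unique (Av213ᴸ n)
  Av213ᴸ-unique n = Unique.map⁺ entries-injective (Av213-unique n)

  ∈-Av213ᴸ⁻ : ∀ {n ℓ} → ℓ ∈ Av213ᴸ n → IsAv213 0 n ℓ
  ∈-Av213ᴸ⁻ ℓ∈ with π , π∈ , refl ← ∈-map⁻ entries ℓ∈ with perm , av ← ∈-Av213⁻ π∈ = record
    { unique   = LookupInjective⇒Unique π perm
    ; bounded  = λ v∈ → z≤n , entries-bounded π v∈
    ; complete = λ _ → LookupInjective⇒∈-entries π perm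
    ; avoids   = Avoids213⇒Avoids213ᴸ π av
    }

  ∈-Av213ᴸ⁺ : ∀ {n ℓ} → IsAv213 0 n ℓ → ℓ ∈ Av213ᴸ n
  ∈-Av213ᴸ⁺ {ℓ = ℓ} av
    with π , refl ← fromEntries ℓ (All.tabulate (λ v∈ → proj₂ (IsAv213.bounded av v∈))) (IsAv213-length av) =
    ∈-map⁺ entries (∈-Av213⁺ (Unique⇒LookupInjective π (IsAv213.unique av)) (Avoids213ᴸ⇒Avoids213 π (IsAv213.avoids av)))

module Decomposition where

  open Arrangements
  open Words using (Av213ᴸ; Av213ᴸ-unique; ∈-Av213ᴸ⁻; ∈-Av213ᴸ⁺)
  open UniqueLists using (Unique-concatMap⁺; Unique∧⊆∧⊇⇒↭)
  open import Data.Nat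
  open import Data.Nat.Properties
  open import Data.List using (List; []; _∷_; _++_; map; length; concatMap; cartesianProductWith; upTo)
  import Data.List.Properties as List
  open import Data.List.Relation.Unary.Unique.Propositional using (Unique)
  import Data.List.Relation.Unary.Unique.Propositional.Properties as Unique
  open import Data.List.Relation.Unary.All as All using (All; []; _∷_)
  import Data.List.Relation.Unary.All.Properties as All
  import Data.List.Relation.Unary.Any as Any
  open import Data.List.Membership.Propositional using (_∈_; find)
  open import Data.List.Membership.Propositional.Properties
  open import Data.List.Relation.Binary.Permutation.Propositional using (_↭_)
  open import Data.Product using (_×_; _,_; ∃; ∃₂)
  open import Relation.Binary.PropositionalEquality

  glue : List ℕ → List ℕ → List ℕ
  glue α β = shift (suc (length β)) α ++ 0 ∷ shift 1 β

  ++-0∷-injective : ∀ xs xs′ {ys ys′} → All (0 <_) xs → All (0 <_) xs′ →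
    xs ++ 0 ∷ ys ≡ xs′ ++ 0 ∷ ys′ → xs ≡ xs′ × ys ≡ ys′
  ++-0∷-injective []       []         _        _        eq = refl , List.∷-injectiveʳ eq
  ++-0∷-injective []       (_ ∷ _)    _        (() ∷ _) refl
  ++-0∷-injective (_ ∷ _)  []         (() ∷ _) _        refl
  ++-0∷-injective (x ∷ xs) (x′ ∷ xs′) (_ ∷ p)  (_ ∷ p′) eq
    with xs≡ , ys≡ ← ++-0∷-injective xs xs′ p p′ (List.∷-injectiveʳ eq) =
    cong₂ _∷_ (List.∷-injectiveˡ eq) xs≡ , ys≡

  shift-suc-positive : ∀ k xs → All (0 <_) (shift (suc k) xs)
  shift-suc-positive k xs = All.map⁺ (All.universal (λ _ → s≤s z≤n) xs)

  glue-injective : ∀ {α α′ β β′} → glue α β ≡ glue α′ β′ → α ≡ α′ × β ≡ β′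
  glue-injective {α} {α′} {β} {β′} eq
    with shifted-α≡ , shifted-β≡ ← ++-0∷-injective _ _ (shift-suc-positive _ α) (shift-suc-positive _ α′) eq
    with refl ← List.map-injective suc-injective shifted-β≡ =
    List.map-injective (+-cancelˡ-≡ (suc (length β)) _ _) shifted-α≡ , refl

  IsAv213-glue : ∀ {j m α β} → j ≤ m → IsAv213 0 (m ∸ j) α → IsAv213 0 j β → IsAv213 0 (suc m) (glue α β)
  IsAv213-glue {j} {m} {α} {β} j≤m avα avβ =
    subst (λ k → IsAv213 0 (suc m) (shift (suc k) α ++ 0 ∷ shift 1 β)) (sym (IsAv213-length avβ))
      (IsAv213-++-0∷ (s≤s z≤n) (s≤s j≤m) shifted-α (IsAv213-shift 1 avβ))
    where
    shifted-α : IsAv213 (suc j) (suc m) (shift (suc j) α)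
    shifted-α = subst (λ hi → IsAv213 (suc j) hi (shift (suc j) α)) (cong suc (m+[n∸m]≡n j≤m)) (IsAv213-shift (suc j) avα)

  glue-of-split : ∀ {m} t {A B} → 0 < t → t ≤ suc m → IsAv213 t (suc m) A → IsAv213 1 t B →
    ∃ λ j → ∃₂ λ α β → j ≤ m × α ∈ Av213ᴸ (m ∸ j) × β ∈ Av213ᴸ j × A ++ 0 ∷ B ≡ glue α β
  glue-of-split {m} (suc j) {A} _ (s≤s j≤m) avA avB
    with α , refl , avα ← IsAv213-unshift (suc j) (subst (λ hi → IsAv213 (suc j) hi A) (cong suc (sym (m+[n∸m]≡n j≤m))) avA)
    with β , refl , avβ ← IsAv213-unshift 1 avB =
    j , α , β , j≤m , ∈-Av213ᴸ⁺ avα , ∈-Av213ᴸ⁺ avβ ,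
    cong (λ k → shift (suc k) α ++ 0 ∷ shift 1 β) (sym (IsAv213-length avβ))

  IsAv213-unglue : ∀ {m ℓ} → IsAv213 0 (suc m) ℓ →
    ∃ λ j → ∃₂ λ α β → j ≤ m × α ∈ Av213ᴸ (m ∸ j) × β ∈ Av213ᴸ j × ℓ ≡ glue α β
  IsAv213-unglue av with A , B , refl ← ∈-∃++ (IsAv213.complete av z≤n (s≤s z≤n)) =
    glue-of-split t 0<t t≤1+m left right
    where open SplitAtZero A B av

  gluingsAt : ℕ → ℕ → List (List ℕ)
  gluingsAt m j = cartesianProductWith glue (Av213ᴸ (m ∸ j)) (Av213ᴸ j)

  gluings : ℕ → List (List ℕ)
  gluings m = concatMap (gluingsAt m) (upTo (suc m))

  gluings-unique : ∀ m → Unique (gluings m)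
  gluings-unique m = Unique-concatMap⁺ (gluingsAt m) (Unique.upTo⁺ (suc m))
    (λ j → Unique.cartesianProductWith⁺ glue glue-injective (Av213ᴸ-unique (m ∸ j)) (Av213ᴸ-unique j)) same-j
    where
    same-j : ∀ {j₁ j₂ ℓ} → ℓ ∈ gluingsAt m j₁ → ℓ ∈ gluingsAt m j₂ → j₁ ≡ j₂
    same-j {j₁} {j₂} ℓ∈₁ ℓ∈₂
      with _ , _ , _ , β∈₁ , refl ← ∈-cartesianProductWith⁻ glue (Av213ᴸ (m ∸ j₁)) (Av213ᴸ j₁) ℓ∈₁
      with _ , _ , _ , β∈₂ , eq   ← ∈-cartesianProductWith⁻ glue (Av213ᴸ (m ∸ j₂)) (Av213ᴸ j₂) ℓ∈₂
      with _ , refl ← glue-injective eq =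
      trans (sym (IsAv213-length (∈-Av213ᴸ⁻ β∈₁))) (IsAv213-length (∈-Av213ᴸ⁻ β∈₂))

  ∈-gluings⁻ : ∀ {m ℓ} → ℓ ∈ gluings m → IsAv213 0 (suc m) ℓ
  ∈-gluings⁻ {m} ℓ∈ with j , j∈ , ℓ∈ⱼ ← find (∈-concatMap⁻ (gluingsAt m) {xs = upTo (suc m)} ℓ∈)
    with α , β , α∈ , β∈ , refl ← ∈-cartesianProductWith⁻ glue (Av213ᴸ (m ∸ j)) (Av213ᴸ j) ℓ∈ⱼ =
    IsAv213-glue (≤-pred (∈-upTo⁻ j∈)) (∈-Av213ᴸ⁻ α∈) (∈-Av213ᴸ⁻ β∈)

  ∈-gluings⁺ : ∀ {m ℓ} → IsAv213 0 (suc m) ℓ → ℓ ∈ gluings m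
  ∈-gluings⁺ {m} av with j , α , β , j≤m , α∈ , β∈ , refl ← IsAv213-unglue av =
    ∈-concatMap⁺ (gluingsAt m) (Any.map (λ { refl → ∈-cartesianProductWith⁺ glue α∈ β∈ }) (∈-upTo⁺ (s≤s j≤m)))

  Av213ᴸ-suc↭gluings : ∀ m → Av213ᴸ (suc m) ↭ gluings m
  Av213ᴸ-suc↭gluings m = Unique∧⊆∧⊇⇒↭ (Av213ᴸ-unique (suc m)) (gluings-unique m)
    (λ ℓ∈ → ∈-gluings⁺ (∈-Av213ᴸ⁻ ℓ∈)) (λ ℓ∈ → ∈-Av213ᴸ⁺ (∈-gluings⁻ ℓ∈))

module AdjacentMinima where

  open Arrangements using (shift)
  open Decomposition using (glue)
  open import Data.Nat
  open import Data.Nat.Properties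
  open import Data.Nat.Solver using (module +-*-Solver)
  open import Data.List using (List; []; _∷_; _++_; map; length)
  import Data.List.Properties as List
  open import Relation.Binary.PropositionalEquality
  open +-*-Solver

  adjMinSum-shift : ∀ k xs → adjMinSum (shift k xs) ≡ k * (length xs ∸ 1) + adjMinSum xs
  adjMinSum-shift k []           = cong (_+ 0) (sym (*-zeroʳ k))
  adjMinSum-shift k (x ∷ [])     = cong (_+ 0) (sym (*-zeroʳ k))
  adjMinSum-shift k (x ∷ y ∷ zs) = begin
    (k + x) ⊓ (k + y) + adjMinSum (shift k (y ∷ zs))
      ≡⟨ cong₂ _+_ (sym (+-distribˡ-⊓ k x y)) (adjMinSum-shift k (y ∷ zs)) ⟩
    (k + x ⊓ y) + (k * length zs + adjMinSum (y ∷ zs))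
      ≡⟨ solve 4 (λ k m L S → (k :+ m) :+ (k :* L :+ S) := k :* (con 1 :+ L) :+ (m :+ S)) refl k (x ⊓ y) (length zs) _ ⟩
    k * suc (length zs) + (x ⊓ y + adjMinSum (y ∷ zs))
      ∎
    where open ≡-Reasoning

  sgn : ℕ → ℕ
  sgn zero    = 0
  sgn (suc _) = 1

  -- Each of the two new adjacent pairs around the 1 contributes min = 1 exactly when it exists.
  adjMinSum-++-1∷ : ∀ xs ys → adjMinSum (map suc xs ++ 1 ∷ map suc ys) ≡
    adjMinSum (map suc xs) + sgn (length xs) + sgn (length ys) + adjMinSum (map suc ys)
  adjMinSum-++-1∷ []           []       = refl
  adjMinSum-++-1∷ []           (_ ∷ _)  = refl
  adjMinSum-++-1∷ (x ∷ [])     ys       =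
    cong suc (trans (cong (_+ adjMinSum (1 ∷ map suc ys)) (⊓-zeroʳ x)) (adjMinSum-++-1∷ [] ys))
  adjMinSum-++-1∷ (x ∷ y ∷ xs) ys       = begin
    suc x ⊓ suc y + adjMinSum (map suc (y ∷ xs) ++ 1 ∷ map suc ys)
      ≡⟨ cong (suc x ⊓ suc y +_) (adjMinSum-++-1∷ (y ∷ xs) ys) ⟩
    suc x ⊓ suc y + (adjMinSum (map suc (y ∷ xs)) + 1 + sgn (length ys) + adjMinSum (map suc ys))
      ≡⟨ solve 4 (λ a b c d → a :+ (b :+ con 1 :+ c :+ d) := a :+ b :+ con 1 :+ c :+ d) refl
           (suc x ⊓ suc y) (adjMinSum (map suc (y ∷ xs))) (sgn (length ys)) (adjMinSum (map suc ys)) ⟩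
    suc x ⊓ suc y + adjMinSum (map suc (y ∷ xs)) + 1 + sgn (length ys) + adjMinSum (map suc ys)
      ∎
    where open ≡-Reasoning

  -- Entries are stored 0-based, while Hₙ sums minima of the 1-based values.
  weight : List ℕ → ℕ
  weight ℓ = adjMinSum (map suc ℓ)

  weight-shift : ∀ k xs → weight (shift k xs) ≡ weight xs + k * (length xs ∸ 1)
  weight-shift k xs = begin
    adjMinSum (map suc (shift k xs))               ≡⟨ cong adjMinSum (sym (List.map-∘ xs)) ⟩
    adjMinSum (shift (suc k) xs)                   ≡⟨ adjMinSum-shift (suc k) xs ⟩
    suc k * (length xs ∸ 1) + adjMinSum xs         ≡⟨ solve 3 (λ k L S → (con 1 :+ k) :* L :+ S := (con 1 :* L :+ S) :+ k :* L) refl k (length xs ∸ 1) (adjMinSum xs) ⟩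
    (1 * (length xs ∸ 1) + adjMinSum xs) + k * (length xs ∸ 1) ≡⟨ cong (_+ k * (length xs ∸ 1)) (adjMinSum-shift 1 xs) ⟨
    weight xs + k * (length xs ∸ 1)                ∎
    where open ≡-Reasoning

  whenZero : ℕ → ℕ → ℕ
  whenZero zero    j = j
  whenZero (suc _) _ = 0

  glueExcess : ℕ → ℕ → ℕ
  glueExcess i j = i * suc j + whenZero i j

  glueExcess-≡ : ∀ i j → suc j * (i ∸ 1) + sgn i + sgn j + 1 * (j ∸ 1) ≡ glueExcess i j
  glueExcess-≡ zero    zero    = refl
  glueExcess-≡ zero    (suc j) = solve 1 (λ j → (con 2 :+ j) :* con 0 :+ con 0 :+ con 1 :+ con 1 :* j := con 1 :+ j) refl j
  glueExcess-≡ (suc i) zero    = solve 1 (λ i → con 1 :* i :+ con 1 :+ con 0 :+ con 1 :* con 0 := (con 1 :+ i) :* con 1 :+ con 0) refl i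
  glueExcess-≡ (suc i) (suc j) = solve 2 (λ i j → (con 2 :+ j) :* i :+ con 1 :+ con 1 :+ con 1 :* j := (con 1 :+ i) :* (con 2 :+ j) :+ con 0) refl i j

  weight-glue : ∀ α β → weight (glue α β) ≡ weight α + weight β + glueExcess (length α) (length β)
  weight-glue α β = begin
    adjMinSum (map suc (shift c α ++ 0 ∷ shift 1 β))
      ≡⟨ cong adjMinSum (List.map-++ suc (shift c α) (0 ∷ shift 1 β)) ⟩
    adjMinSum (map suc (shift c α) ++ 1 ∷ map suc (shift 1 β))
      ≡⟨ adjMinSum-++-1∷ (shift c α) (shift 1 β) ⟩
    weight (shift c α) + sgn (length (shift c α)) + sgn (length (shift 1 β)) + weight (shift 1 β)
      ≡⟨ cong₂ (λ u v → weight (shift c α) + sgn u + sgn v + weight (shift 1 β)) (List.length-map (c +_) α) (List.length-map (1 +_) β) ⟩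
    weight (shift c α) + sgn i + sgn j + weight (shift 1 β)
      ≡⟨ cong₂ (λ u v → u + sgn i + sgn j + v) (weight-shift c α) (weight-shift 1 β) ⟩
    (weight α + c * (i ∸ 1)) + sgn i + sgn j + (weight β + 1 * (j ∸ 1))
      ≡⟨ solve 6 (λ a b p q r s → (a :+ p) :+ q :+ r :+ (b :+ s) := a :+ b :+ (p :+ q :+ r :+ s)) refl
           (weight α) (weight β) (c * (i ∸ 1)) (sgn i) (sgn j) (1 * (j ∸ 1)) ⟩
    weight α + weight β + (c * (i ∸ 1) + sgn i + sgn j + 1 * (j ∸ 1))
      ≡⟨ cong (weight α + weight β +_) (glueExcess-≡ i j) ⟩
    weight α + weight β + glueExcess i j
      ∎
    where
    open ≡-Reasoning
    c = suc (length β)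
    i = length α
    j = length β

module Counting where

  open Words using (Av213ᴸ; ∈-Av213ᴸ⁻)
  open Arrangements using (IsAv213-length)
  open Decomposition using (glue; gluingsAt; gluings; Av213ᴸ-suc↭gluings)
  open AdjacentMinima using (weight; weight-glue; glueExcess)
  open import Data.Nat
  open import Data.Nat.Properties
  open import Data.Nat.Solver using (module +-*-Solver)
  open import Data.Nat.ListAction using (sum)
  open import Data.Nat.ListAction.Properties using (sum-++; sum-↭)
  open import Data.List using (List; []; _∷_; _++_; map; length; concatMap; cartesianProductWith; upTo)
  import Data.List.Properties as List
  open import Data.Vec using (toList)
  open import Data.List.Relation.Unary.Any using (here; there)
  open import Data.List.Membership.Propositional using (_∈_)
  import Data.List.Relation.Binary.Permutation.Propositional.Properties as Perm
  open import Relation.Binary.PropositionalEquality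
  open import Function using (_∘_)
  open +-*-Solver

  private
    variable
      A B C : Set

  length-concatMap : ∀ (f : A → List B) xs → length (concatMap f xs) ≡ sum (map (length ∘ f) xs)
  length-concatMap f []       = refl
  length-concatMap f (x ∷ xs) = trans (List.length-++ (f x)) (cong (length (f x) +_) (length-concatMap f xs))

  sum-concatMap : ∀ (g : B → ℕ) (f : A → List B) xs →
    sum (map g (concatMap f xs)) ≡ sum (map (λ x → sum (map g (f x))) xs)
  sum-concatMap g f []       = refl
  sum-concatMap g f (x ∷ xs) = begin
    sum (map g (f x ++ concatMap f xs))                    ≡⟨ cong sum (List.map-++ g (f x) _) ⟩
    sum (map g (f x) ++ map g (concatMap f xs))            ≡⟨ sum-++ (map g (f x)) _ ⟩
    sum (map g (f x)) + sum (map g (concatMap f xs))       ≡⟨ cong (sum (map g (f x)) +_) (sum-concatMap g f xs) ⟩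
    sum (map g (f x)) + sum (map (λ x → sum (map g (f x))) xs) ∎
    where open ≡-Reasoning

  length-cartesianProductWith : ∀ (f : A → B → C) xs ys →
    length (cartesianProductWith f xs ys) ≡ length xs * length ys
  length-cartesianProductWith f []       ys = refl
  length-cartesianProductWith f (x ∷ xs) ys =
    trans (List.length-++ (map (f x) ys)) (cong₂ _+_ (List.length-map (f x) ys) (length-cartesianProductWith f xs ys))

  sum-cartesianProductWith : ∀ (w : C → ℕ) (f : A → B → C) (u : A → ℕ) (v : B → ℕ) K xs ys →
    (∀ {x y} → x ∈ xs → y ∈ ys → w (f x y) ≡ u x + v y + K) →
    sum (map w (cartesianProductWith f xs ys)) ≡
      length ys * sum (map u xs) + length xs * sum (map v ys) + length xs * length ys * K
  sum-cartesianProductWith w f u v K []       ys _      =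
    sym (trans (+-identityʳ _) (trans (+-identityʳ _) (*-zeroʳ (length ys))))
  sum-cartesianProductWith w f u v K (x ∷ xs) ys w-split = begin
    sum (map w (map (f x) ys ++ cartesianProductWith f xs ys))
      ≡⟨ trans (cong sum (List.map-++ w (map (f x) ys) _)) (sum-++ (map w (map (f x) ys)) _) ⟩
    sum (map w (map (f x) ys)) + sum (map w (cartesianProductWith f xs ys))
      ≡⟨ cong₂ _+_ (row ys (λ y∈ → w-split (here refl) y∈)) (sum-cartesianProductWith w f u v K xs ys (w-split ∘ there)) ⟩
    (length ys * u x + sum (map v ys) + length ys * K) + (length ys * sum (map u xs) + length xs * sum (map v ys) + length xs * length ys * K)
      ≡⟨ solve 6 (λ Ly ux Sv K Su Lx → (Ly :* ux :+ Sv :+ Ly :* K) :+ (Ly :* Su :+ Lx :* Sv :+ Lx :* Ly :* K)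
                                    := Ly :* (ux :+ Su) :+ (con 1 :+ Lx) :* Sv :+ (con 1 :+ Lx) :* Ly :* K)
               refl (length ys) (u x) (sum (map v ys)) K (sum (map u xs)) (length xs) ⟩
    length ys * (u x + sum (map u xs)) + suc (length xs) * sum (map v ys) + suc (length xs) * length ys * K
      ∎
    where
    open ≡-Reasoning
    row : ∀ ys → (∀ {y} → y ∈ ys → w (f x y) ≡ u x + v y + K) →
      sum (map w (map (f x) ys)) ≡ length ys * u x + sum (map v ys) + length ys * K
    row []       _       = refl
    row (y ∷ ys) w-split′ = begin
      w (f x y) + sum (map w (map (f x) ys))
        ≡⟨ cong₂ _+_ (w-split′ (here refl)) (row ys (w-split′ ∘ there)) ⟩
      u x + v y + K + (length ys * u x + sum (map v ys) + length ys * K)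
        ≡⟨ solve 5 (λ c h K L S → c :+ h :+ K :+ (L :* c :+ S :+ L :* K) := (con 1 :+ L) :* c :+ (h :+ S) :+ (con 1 :+ L) :* K)
                 refl (u x) (v y) K (length ys) (sum (map v ys)) ⟩
      suc (length ys) * u x + (v y + sum (map v ys)) + suc (length ys) * K
        ∎

  countAv : ℕ → ℕ
  countAv n = length (Av213ᴸ n)

  weightAv : ℕ → ℕ
  weightAv n = sum (map weight (Av213ᴸ n))

  Hnum≡weightAv : ∀ n → Hnum n ≡ weightAv n
  Hnum≡weightAv n = cong sum (trans (List.map-cong (λ π → cong adjMinSum (List.map-∘ (toList π))) (Av213 n))
                                    (List.map-∘ (Av213 n)))

  countAv-suc : ∀ m → countAv (suc m) ≡ sum (map (λ j → countAv (m ∸ j) * countAv j) (upTo (suc m)))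
  countAv-suc m = begin
    length (Av213ᴸ (suc m))   ≡⟨ Perm.↭-length (Av213ᴸ-suc↭gluings m) ⟩
    length (gluings m)        ≡⟨ length-concatMap (gluingsAt m) (upTo (suc m)) ⟩
    sum (map (length ∘ gluingsAt m) (upTo (suc m)))
      ≡⟨ cong sum (List.map-cong (λ j → length-cartesianProductWith glue (Av213ᴸ (m ∸ j)) (Av213ᴸ j)) (upTo (suc m))) ⟩
    sum (map (λ j → countAv (m ∸ j) * countAv j) (upTo (suc m))) ∎
    where open ≡-Reasoning

  weightAv-suc : ∀ m → weightAv (suc m) ≡ sum (map (λ j →
    countAv j * weightAv (m ∸ j) + countAv (m ∸ j) * weightAv j + countAv (m ∸ j) * countAv j * glueExcess (m ∸ j) j) (upTo (suc m)))
  weightAv-suc m = begin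
    sum (map weight (Av213ᴸ (suc m)))    ≡⟨ sum-↭ (Perm.map⁺ weight (Av213ᴸ-suc↭gluings m)) ⟩
    sum (map weight (gluings m))         ≡⟨ sum-concatMap weight (gluingsAt m) (upTo (suc m)) ⟩
    sum (map (λ j → sum (map weight (gluingsAt m j))) (upTo (suc m)))
      ≡⟨ cong sum (List.map-cong block (upTo (suc m))) ⟩
    _ ∎
    where
    open ≡-Reasoning
    block : ∀ j → sum (map weight (gluingsAt m j)) ≡
      countAv j * weightAv (m ∸ j) + countAv (m ∸ j) * weightAv j + countAv (m ∸ j) * countAv j * glueExcess (m ∸ j) j
    block j = sum-cartesianProductWith weight glue weight weight (glueExcess (m ∸ j) j) (Av213ᴸ (m ∸ j)) (Av213ᴸ j)
      λ {α} {β} α∈ β∈ → trans (weight-glue α β)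
        (cong₂ (λ i k → weight α + weight β + glueExcess i k) (IsAv213-length (∈-Av213ᴸ⁻ α∈)) (IsAv213-length (∈-Av213ᴸ⁻ β∈)))

module GeneratingFunctions where

  open PowerSeries
  open CatalanSeries using (functional-equation⇒catalan)
  open Counting
  open AdjacentMinima using (glueExcess; whenZero)
  open import Data.Nat as ℕ using (ℕ; zero; suc; _∸_)
  import Data.Nat.Properties as ℕ
  open import Data.Nat.Solver using () renaming (module +-*-Solver to NatSolver)
  open import Data.Nat.ListAction using (sum)
  open import Data.List using (map; upTo; applyUpTo)
  import Data.List.Properties as List
  open import Data.Integer as ℤ using (ℤ; +_; _+_; _*_)
  import Data.Integer.Properties as ℤ
  open import Relation.Binary.PropositionalEquality
  open import Function using (_∘_)
  open import Relation.Binary.Reasoning.Setoid fps-setoid as ≈-Reasoning using ()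

  pos-sum-applyUpTo : ∀ m (f : ℕ → ℕ) → + sum (applyUpTo f (suc m)) ≡ sumTo m (λ j → + f j)
  pos-sum-applyUpTo zero    f = cong +_ (ℕ.+-identityʳ (f 0))
  pos-sum-applyUpTo (suc m) f = begin
    + (f 0 ℕ.+ sum (applyUpTo (f ∘ suc) (suc m)))     ≡⟨ ℤ.pos-+ (f 0) _ ⟩
    + f 0 + + sum (applyUpTo (f ∘ suc) (suc m))       ≡⟨ cong (λ s → + f 0 + s) (pos-sum-applyUpTo m (f ∘ suc)) ⟩
    + f 0 + sumTo m (λ j → + f (suc j))               ≡⟨ sumTo-suc m (λ j → + f j) ⟨
    sumTo (suc m) (λ j → + f j)                       ∎
    where open ≡-Reasoning

  pos-sum-upTo : ∀ m (f : ℕ → ℕ) → + sum (map f (upTo (suc m))) ≡ sumTo m (λ j → + f j)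
  pos-sum-upTo m f = trans (cong (λ xs → + sum xs) (List.map-upTo f (suc m))) (pos-sum-applyUpTo m f)

  countAv-equation : ofℕ countAv ≈ one ⊕ X ⊛ (ofℕ countAv ⊛ ofℕ countAv)
  countAv-equation = mk≈ coefficients
    where
    A = ofℕ countAv
    coefficients : A ≋ one ⊕ X ⊛ (A ⊛ A)
    coefficients zero    = refl
    coefficients (suc m) = begin
      + countAv (suc m)                                                 ≡⟨ cong +_ (countAv-suc m) ⟩
      + sum (map (λ j → countAv (m ∸ j) ℕ.* countAv j) (upTo (suc m)))  ≡⟨ pos-sum-upTo m _ ⟩
      sumTo m (λ j → + (countAv (m ∸ j) ℕ.* countAv j))                 ≡⟨ sumTo-cong m (λ j _ → trans (ℤ.pos-* (countAv (m ∸ j)) (countAv j)) (ℤ.*-comm (A (m ∸ j)) (A j))) ⟩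
      (A ⊛ A) m                                                         ≡⟨ X⊛-suc (A ⊛ A) m ⟨
      (X ⊛ (A ⊛ A)) (suc m)                                             ≡⟨ ℤ.+-identityˡ _ ⟨
      (one ⊕ X ⊛ (A ⊛ A)) (suc m)                                       ∎
      where open ≡-Reasoning

  countAv≡catalan : ∀ n → countAv n ≡ catalan n
  countAv≡catalan = functional-equation⇒catalan countAv countAv-equation

  Cser-equation : Cser ≈ one ⊕ X ⊛ (Cser ⊛ Cser)
  Cser-equation = begin
    Cser                         ≈⟨ C≈A ⟩
    A                            ≈⟨ countAv-equation ⟩
    one ⊕ X ⊛ (A ⊛ A)            ≈⟨ ⊕-cong (≈-refl {one}) (⊛-cong≈ (≈-refl {X}) (⊛-cong≈ (≈-sym C≈A) (≈-sym C≈A))) ⟩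
    one ⊕ X ⊛ (Cser ⊛ Cser)      ∎
    where
    open ≈-Reasoning
    A = ofℕ countAv
    C≈A : Cser ≈ A
    C≈A = mk≈ λ n → cong +_ (sym (countAv≡catalan n))

  Hser≡weightAv : ∀ n → Hser n ≡ + weightAv n
  Hser≡weightAv zero    = refl
  Hser≡weightAv (suc n) = cong +_ (Hnum≡weightAv (suc n))

  pos-summand : ∀ cj ci hi hj i j z →
    + (cj ℕ.* hi ℕ.+ ci ℕ.* hj ℕ.+ ci ℕ.* cj ℕ.* (i ℕ.* suc j ℕ.+ z)) ≡
    + cj * + hi + + hj * + ci + (+ cj + + j * + cj) * (+ i * + ci) + + (ci ℕ.* cj ℕ.* z)
  pos-summand cj ci hi hj i j z = begin
    + (cj ℕ.* hi ℕ.+ ci ℕ.* hj ℕ.+ ci ℕ.* cj ℕ.* (i ℕ.* suc j ℕ.+ z))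
      ≡⟨ cong +_ (NatSolver.solve 7 (λ cj ci hi hj i j z →
           cj :* hi :+ ci :* hj :+ ci :* cj :* (i :* (con 1 :+ j) :+ z) :=
           cj :* hi :+ hj :* ci :+ (cj :+ j :* cj) :* (i :* ci) :+ ci :* cj :* z) refl cj ci hi hj i j z) ⟩
    + (cj ℕ.* hi ℕ.+ hj ℕ.* ci ℕ.+ (cj ℕ.+ j ℕ.* cj) ℕ.* (i ℕ.* ci) ℕ.+ ci ℕ.* cj ℕ.* z)
      ≡⟨ trans (ℤ.pos-+ (a ℕ.+ b ℕ.+ c) d) (cong (_+ + d) (trans (ℤ.pos-+ (a ℕ.+ b) c) (cong (_+ + c) (ℤ.pos-+ a b)))) ⟩
    + (cj ℕ.* hi) + + (hj ℕ.* ci) + + ((cj ℕ.+ j ℕ.* cj) ℕ.* (i ℕ.* ci)) + + (ci ℕ.* cj ℕ.* z)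
      ≡⟨ cong (_+ + (ci ℕ.* cj ℕ.* z)) (cong₂ _+_ (cong₂ _+_ (ℤ.pos-* cj hi) (ℤ.pos-* hj ci)) third) ⟩
    + cj * + hi + + hj * + ci + (+ cj + + j * + cj) * (+ i * + ci) + + (ci ℕ.* cj ℕ.* z)
      ∎
    where
    open ≡-Reasoning
    open NatSolver using (_:*_; _:+_; _:=_; con)
    a = cj ℕ.* hi
    b = hj ℕ.* ci
    c = (cj ℕ.+ j ℕ.* cj) ℕ.* (i ℕ.* ci)
    d = ci ℕ.* cj ℕ.* z
    third : + c ≡ (+ cj + + j * + cj) * (+ i * + ci)
    third = trans (ℤ.pos-* (cj ℕ.+ j ℕ.* cj) (i ℕ.* ci))
                  (cong₂ _*_ (trans (ℤ.pos-+ cj (j ℕ.* cj)) (cong (λ x → + cj + x) (ℤ.pos-* j cj))) (ℤ.pos-* i ci))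

  whenZero-sum : ∀ m → sumTo m (λ j → + (catalan (m ∸ j) ℕ.* catalan j ℕ.* whenZero (m ∸ j) j)) ≡ θ Cser m
  whenZero-sum m = begin
    sumTo m (λ j → + (catalan (m ∸ j) ℕ.* catalan j ℕ.* whenZero (m ∸ j) j))
      ≡⟨ sumTo-last m _ vanishes ⟩
    + (catalan (m ∸ m) ℕ.* catalan m ℕ.* whenZero (m ∸ m) m)
      ≡⟨ cong (λ k → + (catalan k ℕ.* catalan m ℕ.* whenZero k m)) (ℕ.n∸n≡0 m) ⟩
    + (1 ℕ.* catalan m ℕ.* m)
      ≡⟨ cong +_ (trans (ℕ.*-comm (1 ℕ.* catalan m) m) (cong (m ℕ.*_) (ℕ.*-identityˡ (catalan m)))) ⟩
    + (m ℕ.* catalan m)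
      ≡⟨ ℤ.pos-* m (catalan m) ⟩
    θ Cser m
      ∎
    where
    open ≡-Reasoning
    vanishes : ∀ j → j ℕ.< m → + (catalan (m ∸ j) ℕ.* catalan j ℕ.* whenZero (m ∸ j) j) ≡ + 0
    vanishes j j<m with m ∸ j | ℕ.m<n⇒0<n∸m j<m
    ... | suc k | _ = cong +_ (ℕ.*-zeroʳ (catalan (suc k) ℕ.* catalan j))

  pos-weightAv-summand : ∀ m j →
    + (countAv j ℕ.* weightAv (m ∸ j) ℕ.+ countAv (m ∸ j) ℕ.* weightAv j ℕ.+ countAv (m ∸ j) ℕ.* countAv j ℕ.* glueExcess (m ∸ j) j)
    ≡ Cser j * Hser (m ∸ j) + Hser j * Cser (m ∸ j) + (Cser j + θ Cser j) * θ Cser (m ∸ j)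
      + + (catalan (m ∸ j) ℕ.* catalan j ℕ.* whenZero (m ∸ j) j)
  pos-weightAv-summand m j = begin
    + (countAv j ℕ.* weightAv i ℕ.+ countAv i ℕ.* weightAv j ℕ.+ countAv i ℕ.* countAv j ℕ.* glueExcess i j)
      ≡⟨ cong₂ (λ x y → + (x ℕ.* weightAv i ℕ.+ y ℕ.* weightAv j ℕ.+ y ℕ.* x ℕ.* glueExcess i j)) (countAv≡catalan j) (countAv≡catalan i) ⟩
    + (cj ℕ.* weightAv i ℕ.+ ci ℕ.* weightAv j ℕ.+ ci ℕ.* cj ℕ.* (i ℕ.* suc j ℕ.+ whenZero i j))
      ≡⟨ pos-summand cj ci (weightAv i) (weightAv j) i j (whenZero i j) ⟩
    + cj * + weightAv i + + weightAv j * + ci + (+ cj + + j * + cj) * (+ i * + ci) + corner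
      ≡⟨ cong₂ (λ x y → + cj * x + y * + ci + (+ cj + + j * + cj) * (+ i * + ci) + corner) (sym (Hser≡weightAv i)) (sym (Hser≡weightAv j)) ⟩
    Cser j * Hser i + Hser j * Cser i + (Cser j + θ Cser j) * θ Cser i + corner
      ∎
    where
    open ≡-Reasoning
    i = m ∸ j
    ci = catalan i
    cj = catalan j
    corner = + (ci ℕ.* cj ℕ.* whenZero i j)

  Hser-equation : Hser ≈ X ⊛ (Cser ⊛ Hser ⊕ Hser ⊛ Cser ⊕ (Cser ⊕ θ Cser) ⊛ θ Cser ⊕ θ Cser)
  Hser-equation = mk≈ coefficients
    where
    F : FPS
    F = Cser ⊛ Hser ⊕ Hser ⊛ Cser ⊕ (Cser ⊕ θ Cser) ⊛ θ Cser ⊕ θ Cser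
    coefficients : Hser ≋ X ⊛ F
    coefficients zero    = refl
    coefficients (suc m) = begin
      + Hnum (suc m)
        ≡⟨ cong +_ (trans (Hnum≡weightAv (suc m)) (weightAv-suc m)) ⟩
      + sum (map (λ j → countAv j ℕ.* weightAv (m ∸ j) ℕ.+ countAv (m ∸ j) ℕ.* weightAv j
                        ℕ.+ countAv (m ∸ j) ℕ.* countAv j ℕ.* glueExcess (m ∸ j) j) (upTo (suc m)))
        ≡⟨ pos-sum-upTo m _ ⟩
      sumTo m (λ j → + (countAv j ℕ.* weightAv (m ∸ j) ℕ.+ countAv (m ∸ j) ℕ.* weightAv j
                        ℕ.+ countAv (m ∸ j) ℕ.* countAv j ℕ.* glueExcess (m ∸ j) j))
        ≡⟨ sumTo-cong m (λ j _ → pos-weightAv-summand m j) ⟩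
      sumTo m (λ j → P j + Q j + R j + corner j)
        ≡⟨ sumTo-+ m (λ j → P j + Q j + R j) corner ⟩
      sumTo m (λ j → P j + Q j + R j) + sumTo m corner
        ≡⟨ cong₂ _+_ (trans (sumTo-+ m (λ j → P j + Q j) R) (cong (_+ sumTo m R) (sumTo-+ m P Q))) (whenZero-sum m) ⟩
      F m
        ≡⟨ X⊛-suc F m ⟨
      (X ⊛ F) (suc m)
        ∎
      where
      open ≡-Reasoning
      P Q R corner : ℕ → ℤ
      P j = Cser j * Hser (m ∸ j)
      Q j = Hser j * Cser (m ∸ j)
      R j = (Cser j + θ Cser j) * θ Cser (m ∸ j)
      corner j = + (catalan (m ∸ j) ℕ.* catalan j ℕ.* whenZero (m ∸ j) j)

open import Data.Integer using (+_)
open PowerSeries using (coeff)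
open CatalanSeries using (weighted-catalan-identity)
open GeneratingFunctions using (Cser-equation; Hser-equation)

proposition4p2 : (one ⊖ scale (+ 2) (X ⊛ Cser)) ⊛ Hser
    ≋ X ⊛ ((X ⊛ deriv Cser ⊖ Cser ⊕ one) ⊛ (X ⊛ deriv Cser ⊕ scale (+ 2) Cser))
    ⊕ scale (+ 2) (Cser ⊖ one ⊖ X ⊛ Cser)
proposition4p2 = coeff (weighted-catalan-identity Cser-equation Hser-equation)
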